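{- For every positive integer $n$, $$\sum_{\ell(\lambda)\le n}\binom{n}{m_0(\lambda),m_1(\lambda),\dots}\prod_{i=1}^n q_i^{\lambda_i}=\frac{\sum_{\sigma\in B_n}\prod_{i=1}^n q_i^{2d_i(\sigma)+\varepsilon_i(\sigma)}}{\prod_{i=1}^n(1-q_1^2\cdots q_i^2)}$$ in $\mathbf{Z}[[q_1,\dots,q_n]]$, where the sum on the left is over all partitions $\lambda=(\lambda_1,\dots,\lambda_n)$ with at most $n$ nonzero parts.
   Context: For a partition $\lambda=(\lambda_1\ge\dots\ge\lambda_n\ge0)$, $m_j(\lambda)=|\{1\le i\le n:\lambda_i=j\}|$, and the coefficient is the multinomial coefficient. $B_n$ is the group of signed permutations of $[-n,n]\setminus\{0\}$. For $\sigma\in B_n$: ${\it Des}(\sigma)=\{i\in[n-1]:\sigma(i)>\sigma(i+1)\}$ (usual integer order), $d_i(\sigma)=|\{j\in{\it Des}(\sigma):j\ge i\}|$, $\varepsilon_i(\sigma)=1$ if $\sigma(i)<0$ and $0$ otherwise. -}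

module Defs where

open import Data.Bool using (Bool; true; false; if_then_else_)
open import Data.Nat as ℕ using (ℕ; zero; suc; _∸_; _⊔_; NonZero)
open import Data.Nat.Properties using (_!≢0; m*n≢0)
open import Data.Nat.DivMod using (_/_)
open import Data.Nat using (_!)
open import Data.Integer as ℤ using (ℤ; +_; ∣_∣)
open import Data.Fin using (Fin; toℕ)
open import Data.Vec as Vec using (Vec; []; _∷_; tabulate; toList; zipWith; replicate)
open import Data.Vec.Properties using (≡-dec)
open import Data.List as List using (List; []; _∷_; filter; length; upTo; map; concatMap; foldr; applyUpTo; allFin)
open import Data.List.Relation.Unary.All using (All)
open import Data.List.Relation.Unary.All.Properties using ()
open import Data.List.Relation.Unary.Unique.Propositional using (Unique)
import Data.List.Relation.Unary.Unique.DecPropositional as UniqueDec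
import Data.List.Relation.Unary.All as AllM
open import Relation.Nullary.Decidable using (Dec; yes; no; ⌊_⌋; _×-dec_)
open import Relation.Unary using (Decidable)
open import Data.Product using (_×_)

-- Formal power series in Z[[q_1,...,q_n]]:
-- a series is its coefficient function on exponent vectors
-- (a_1,...,a_n) ∈ ℕ^n, the coefficient of q_1^{a_1}...q_n^{a_n}.

Exp : ℕ → Set
Exp n = Vec ℕ n

Series : ℕ → Set
Series n = Exp n → ℤ

below : ∀ {n} → Exp n → List (Exp n)
below []       = [] ∷ []
below (x ∷ xs) = concatMap (λ i → map (i ∷_) (below xs)) (upTo (suc x))

sumℤ : List ℤ → ℤ
sumℤ = foldr ℤ._+_ (+ 0)

_⊛_ : ∀ {n} → Series n → Series n → Series n
(f ⊛ g) a = sumℤ (map (λ b → f b ℤ.* g (zipWith _∸_ a b)) (below a))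

one : ∀ {n} → Series n
one {n} a = if ⌊ ≡-dec ℕ._≟_ a (replicate n 0) ⌋ then + 1 else + 0

prodS : ∀ {n} → List (Series n) → Series n
prodS = foldr _⊛_ one

_+S_ : ∀ {n} → Series n → Series n → Series n
(f +S g) a = f a ℤ.+ g a

sumS : ∀ {n} → List (Series n) → Series n
sumS = foldr _+S_ (λ _ → + 0)

mono : ∀ {n} → Exp n → Series n
mono e a = if ⌊ ≡-dec ℕ._≟_ a e ⌋ then + 1 else + 0

scale : ∀ {n} → ℕ → Exp n → Exp n
scale k = Vec.map (k ℕ.*_)

sumℕ : ∀ {n} → Exp n → ℕ
sumℕ = Vec.foldr _ ℕ._+_ 0

-- 1/(1 - q^m) = Σ_{k≥0} q^{k m}  (the inverse in Z[[q]] for a nonconstant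
-- monomial m); coefficient of q^a is the number of k with k·m = a.
-- Any such k satisfies k ≤ |a| when m ≠ 0, so k ranges over 0..|a|.
geomInv : ∀ {n} → Exp n → Series n
geomInv m a = + length (filter (λ k → ≡-dec ℕ._≟_ (scale k m) a) (upTo (suc (sumℕ a))))

-- A partition with at most n nonzero parts is a weakly decreasing
-- λ = (λ_1 ≥ ... ≥ λ_n ≥ 0) ∈ ℕ^n; distinct λ give distinct monomials,
-- so the coefficient of q^a is the multinomial if a is weakly decreasing,
-- and 0 otherwise.

weaklyDecreasing : List ℕ → Bool
weaklyDecreasing []           = true
weaklyDecreasing (x ∷ [])     = true
weaklyDecreasing (x ∷ y ∷ xs) = if ⌊ y ℕ.≤? x ⌋ then weaklyDecreasing (y ∷ xs) else false

mult : ∀ {n} → ℕ → Exp n → ℕ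
mult j λ' = length (filter (λ x → x ℕ.≟ j) (toList λ'))

factProd : List ℕ → ℕ
factProd []       = 1
factProd (x ∷ xs) = x ! ℕ.* factProd xs

factProd≢0 : ∀ xs → NonZero (factProd xs)
factProd≢0 []       = _
factProd≢0 (x ∷ xs) = m*n≢0 (x !) (factProd xs) {{x !≢0}} {{factProd≢0 xs}}

maxℕ : ∀ {n} → Exp n → ℕ
maxℕ = Vec.foldr _ _⊔_ 0

-- multinomial coefficient n! / (m_0(λ)! m_1(λ)! ...)
-- (m_j(λ) = 0 for j > max λ, contributing factor 0! = 1)
multinomial : ∀ {n} → Exp n → ℕ
multinomial {n} λ' = (n ! / factProd ms) {{factProd≢0 ms}}
  where ms = map (λ j → mult j λ') (upTo (suc (maxℕ λ')))

lhs : (n : ℕ) → Series n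
lhs n a = if weaklyDecreasing (toList a) then + multinomial a else + 0

-- Signed permutations B_n, as the window (σ(1),...,σ(n)) ∈ ℤ^n with
-- every entry in [-n,n]\{0} and |σ(1)|,...,|σ(n)| pairwise distinct
-- (hence {|σ(i)|} = [n]).  σ is then determined on [-n,-1] by σ(-i) = -σ(i).

intRange : ℕ → List ℤ
intRange n = map (λ k → ℤ._-_ (+ k) (+ n)) (upTo (suc (2 ℕ.* n)))

allVecs : (n k : ℕ) → List (Vec ℤ k)
allVecs n zero    = Vec.[] ∷ []
allVecs n (suc k) = concatMap (λ x → map (x ∷_) (allVecs n k)) (intRange n)

isSignedPerm : ∀ {k} → ℕ → Vec ℤ k → Bool
isSignedPerm n w =
  ⌊ AllM.all? (λ x → (1 ℕ.≤? ∣ x ∣) ×-dec (∣ x ∣ ℕ.≤? n)) (toList w) ⌋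
  ∧′ ⌊ UniqueDec.unique? ℕ._≟_ (map ∣_∣ (toList w)) ⌋
  where
    _∧′_ : Bool → Bool → Bool
    true  ∧′ b = b
    false ∧′ _ = false

Bn : (n : ℕ) → List (Vec ℤ n)
Bn n = List.filterᵇ (isSignedPerm n) (allVecs n n)

-- σ(i) for 1 ≤ i ≤ n (1-indexed; value 0 outside [1,n], never used there)
at : ∀ {n} → Vec ℤ n → ℕ → ℤ
at w i = go (toList w) i
  where
    go : List ℤ → ℕ → ℤ
    go []       _             = + 0
    go (x ∷ xs) zero          = + 0
    go (x ∷ xs) (suc zero)    = x
    go (x ∷ xs) (suc (suc j)) = go xs (suc j)

Des : ∀ {n} → Vec ℤ n → List ℕ
Des {n} σ = filter (λ i → at σ (suc i) ℤ.<? at σ i) (List.map suc (upTo (n ∸ 1)))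

dstat : ∀ {n} → Vec ℤ n → ℕ → ℕ
dstat σ i = length (filter (λ j → i ℕ.≤? j) (Des σ))

eps : ∀ {n} → Vec ℤ n → ℕ → ℕ
eps σ i = if ⌊ at σ i ℤ.<? + 0 ⌋ then 1 else 0

sigmaExp : ∀ {n} → Vec ℤ n → Exp n
sigmaExp {n} σ = tabulate (λ (i : Fin n) → 2 ℕ.* dstat σ (suc (toℕ i)) ℕ.+ eps σ (suc (toℕ i)))

numer : (n : ℕ) → Series n
numer n = sumS (map (λ σ → mono (sigmaExp σ)) (Bn n))

sqPrefix : (n i : ℕ) → Exp n
sqPrefix n i = tabulate (λ (j : Fin n) → if ⌊ toℕ j ℕ.<? i ⌋ then 2 else 0)

rhs : (n : ℕ) → Series n
rhs n = numer n ⊛ prodS (map (λ i → geomInv (sqPrefix n i)) (applyUpTo suc n))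

-- The coefficient of q^a on the right is the number of σ ∈ B_n for which a − e(σ), with
-- e_i(σ) = 2 d_i(σ) + ε_i(σ), is an exponent of Π_i (1 − q_1²⋯q_i²)⁻¹, i.e. twice a weakly
-- decreasing sequence. Since d_i − d_{i+1} = [i ∈ Des σ], this says that σ is compatible with a:
-- σ(i) < 0 exactly when a_i is odd, and ⌊a_{i+1}/2⌋ + [σ(i) > σ(i+1)] ≤ ⌊a_i/2⌋ for all i.
-- Compatibility forces a to be weakly decreasing. For such a, the letter ±n of a compatible σ
-- has its sign fixed by the parity of a_p at its position p, p is the right end (a_p even) or the
-- left end (a_p odd) of its block of equal parts, and deleting it leaves a signed permutation
-- compatible with a minus its p-th part; conversely every such insertion is compatible. Each block
-- has exactly one such position, so the number N(a) of compatible σ satisfies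
-- N(a) · Π_j m_j(a)! = Σ_blocks m_j(a) · (n − 1)! = n!.

module Submission where

open import Defs
import Algebra.Properties.AbelianGroup as AbelianGroupProperties
import Algebra.Properties.CommutativeSemigroup as CommSemigroupProperties
open import Data.Bool using (Bool; true; false; if_then_else_; T; T?)
open import Data.Empty using (⊥; ⊥-elim)
open import Data.Fin using (toℕ)
open import Data.Integer as ℤ using (ℤ; +_; -[1+_]; ∣_∣)
import Data.Integer.Properties as ℤₚ
open import Data.List as List using (List; []; _∷_; _++_; map; filter; length; concatMap; upTo; applyUpTo)
import Data.List.Properties as Listₚ
open import Data.List.Membership.Propositional using (_∈_)
import Data.List.Membership.Propositional.Properties as ∈ₚ
open import Data.List.Relation.Binary.Permutation.Propositional using (_↭_; prep; swap; ↭-refl; ↭-sym; ↭-trans; ↭⇒↭ₛ)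
import Data.List.Relation.Binary.Permutation.Propositional.Properties as ↭ₚ
import Data.List.Relation.Binary.Permutation.Setoid.Properties as ↭ₛₚ
open import Data.List.Relation.Unary.All as All using (All; []; _∷_)
import Data.List.Relation.Unary.All.Properties as Allₚ
open import Data.List.Relation.Unary.AllPairs using ([]; _∷_)
open import Data.List.Relation.Unary.Any using (here; there)
open import Data.List.Relation.Unary.Unique.Propositional using (Unique)
import Data.List.Relation.Unary.Unique.Propositional.Properties as Uniqueₚ
import Data.List.Relation.Unary.Unique.DecPropositional as UniqueDec
open import Data.Nat as ℕ using (ℕ; zero; suc; _+_; _*_; _∸_; _⊔_; _≤_; _<_; z≤n; s≤s; ⌊_/2⌋; _!)
import Data.Nat.Properties as ℕₚ
open import Data.Nat.DivMod using (_/_; m*n/n≡m)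
open import Data.Nat.ListAction using (sum)
open import Data.List.Membership.DecPropositional ℕ._≟_ using (_∈?_)
open import Data.Product using (∃; _×_; _,_; proj₁; proj₂)
open import Data.Sum using (_⊎_; inj₁; inj₂)
open import Data.Vec as Vec using (Vec; []; _∷_; toList; zipWith; replicate; tabulate)
open import Data.Vec.Properties using (≡-dec; length-toList)
open import Function using (_∘_; _$_; case_of_)
open import Relation.Binary.Definitions using (tri<; tri≈; tri>)
open import Relation.Binary.PropositionalEquality
open import Relation.Nullary using (¬_; Dec; yes; no; does)
open import Relation.Nullary.Decidable using (⌊_⌋; dec-true; dec-false; isYes≗does; _×-dec_; _→-dec_; ¬?; map′)
open import Relation.Unary using (Decidable)

private variable
  A B : Set
  l l′ m n : ℕ

indicator : Bool → ℕ
indicator b = if b then 1 else 0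

⌊⌋-true : ∀ {P : Set} (P? : Dec P) → P → ⌊ P? ⌋ ≡ true
⌊⌋-true P? p = trans (isYes≗does P?) (dec-true P? p)

⌊⌋-false : ∀ {P : Set} (P? : Dec P) → ¬ P → ⌊ P? ⌋ ≡ false
⌊⌋-false P? ¬p = trans (isYes≗does P?) (dec-false P? ¬p)

sumℤ-map-+ : ∀ (f g : A → ℤ) xs →
             sumℤ (map (λ x → f x ℤ.+ g x) xs) ≡ sumℤ (map f xs) ℤ.+ sumℤ (map g xs)
sumℤ-map-+ f g []       = refl
sumℤ-map-+ f g (x ∷ xs) = begin
  f x ℤ.+ g x ℤ.+ sumℤ (map (λ x → f x ℤ.+ g x) xs)      ≡⟨ cong (λ s → (f x ℤ.+ g x) ℤ.+ s) (sumℤ-map-+ f g xs) ⟩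
  f x ℤ.+ g x ℤ.+ (sumℤ (map f xs) ℤ.+ sumℤ (map g xs))  ≡⟨ interchange (f x) (g x) _ _ ⟩
  f x ℤ.+ sumℤ (map f xs) ℤ.+ (g x ℤ.+ sumℤ (map g xs))  ∎
  where
  open ≡-Reasoning
  open CommSemigroupProperties ℤₚ.+-commutativeSemigroup using (interchange)

sumℤ-map-0 : ∀ (f : A → ℤ) xs → (∀ {x} → x ∈ xs → f x ≡ + 0) → sumℤ (map f xs) ≡ + 0
sumℤ-map-0 f []       _    = refl
sumℤ-map-0 f (x ∷ xs) f≡0 = cong₂ ℤ._+_ (f≡0 (here refl)) (sumℤ-map-0 f xs (f≡0 ∘ there))

sumℤ-map-single : ∀ (f : A → ℤ) {xs} e → Unique xs → e ∈ xs →
                  (∀ {x} → x ∈ xs → x ≢ e → f x ≡ + 0) → sumℤ (map f xs) ≡ f e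
sumℤ-map-single f {x ∷ xs} e (x∉xs ∷ _) (here refl) f≡0 = begin
  f x ℤ.+ sumℤ (map f xs)  ≡⟨ cong (λ s → f x ℤ.+ s) (sumℤ-map-0 f xs λ y∈ → f≡0 (there y∈) (All.lookup x∉xs y∈ ∘ sym)) ⟩
  f x ℤ.+ + 0              ≡⟨ ℤₚ.+-identityʳ (f x) ⟩
  f x                      ∎
  where open ≡-Reasoning
sumℤ-map-single f {x ∷ xs} e (x∉xs ∷ u) (there e∈xs) f≡0 = begin
  f x ℤ.+ sumℤ (map f xs)  ≡⟨ cong₂ ℤ._+_ (f≡0 (here refl) (All.lookup x∉xs e∈xs)) (sumℤ-map-single f e u e∈xs (f≡0 ∘ there)) ⟩
  + 0 ℤ.+ f e              ≡⟨ ℤₚ.+-identityˡ (f e) ⟩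
  f e                      ∎
  where open ≡-Reasoning

sumℤ-indicator : ∀ {P : A → Set} (P? : Decidable P) xs →
                 sumℤ (map (λ x → + indicator (does (P? x))) xs) ≡ + length (filter P? xs)
sumℤ-indicator P? []       = refl
sumℤ-indicator P? (x ∷ xs) with does (P? x)
... | true  = cong (λ s → + 1 ℤ.+ s) (sumℤ-indicator P? xs)
... | false = trans (ℤₚ.+-identityˡ _) (sumℤ-indicator P? xs)

sum-map-*ʳ : ∀ (f : A → ℕ) c xs → sum (map f xs) * c ≡ sum (map (λ x → f x * c) xs)
sum-map-*ʳ f c []       = refl
sum-map-*ʳ f c (x ∷ xs) = trans (ℕₚ.*-distribʳ-+ c (f x) _) (cong (_+_ (f x * c)) (sum-map-*ʳ f c xs))

sum-map-0 : ∀ (xs : List A) → sum (map (λ _ → 0) xs) ≡ 0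
sum-map-0 []       = refl
sum-map-0 (_ ∷ xs) = sum-map-0 xs

sum-map-1 : ∀ (xs : List A) → sum (map (λ _ → 1) xs) ≡ length xs
sum-map-1 []       = refl
sum-map-1 (_ ∷ xs) = cong suc (sum-map-1 xs)

sum-map-+ : ∀ (f g : A → ℕ) xs → sum (map (λ x → f x + g x) xs) ≡ sum (map f xs) + sum (map g xs)
sum-map-+ f g []       = refl
sum-map-+ f g (x ∷ xs) = trans (cong (_+_ (f x + g x)) (sum-map-+ f g xs)) (interchange (f x) (g x) _ _)
  where open CommSemigroupProperties ℕₚ.+-commutativeSemigroup using (interchange)

sum-map-swap : ∀ (F : A → B → ℕ) xs ys →
               sum (map (λ x → sum (map (F x) ys)) xs) ≡ sum (map (λ y → sum (map (λ x → F x y) xs)) ys)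
sum-map-swap F []       ys = sym (sum-map-0 ys)
sum-map-swap F (x ∷ xs) ys = trans (cong (_+_ (sum (map (F x) ys))) (sum-map-swap F xs ys))
                                   (sym (sum-map-+ (F x) (λ y → sum (map (λ x → F x y) xs)) ys))

length-filter≡sum : ∀ {P : A → Set} (P? : Decidable P) xs →
                    length (filter P? xs) ≡ sum (map (λ x → indicator (does (P? x))) xs)
length-filter≡sum P? []       = refl
length-filter≡sum P? (x ∷ xs) with does (P? x)
... | true  = cong suc (length-filter≡sum P? xs)
... | false = length-filter≡sum P? xs

length-filter≡1 : ∀ {P : A → Set} (P? : Decidable P) {xs} e → Unique xs → e ∈ xs → P e →
                  (∀ {x} → x ∈ xs → P x → x ≡ e) → length (filter P? xs) ≡ 1
length-filter≡1 P? {x ∷ xs} e (x∉xs ∷ _) (here refl) Pe unique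
  rewrite Listₚ.filter-accept P? {xs = xs} Pe
        | Listₚ.filter-none P? (All.tabulate λ y∈ Py → All.lookup x∉xs y∈ (sym (unique (there y∈) Py))) = refl
length-filter≡1 P? {x ∷ xs} e (x∉xs ∷ u) (there e∈xs) Pe unique
  rewrite Listₚ.filter-reject P? {xs = xs} (All.lookup x∉xs e∈xs ∘ unique (here refl)) =
  length-filter≡1 P? e u e∈xs Pe (unique ∘ there)

length-concatMap : ∀ (f : A → List B) xs → length (concatMap f xs) ≡ sum (map (length ∘ f) xs)
length-concatMap f []       = refl
length-concatMap f (x ∷ xs) = trans (Listₚ.length-++ (f x)) (cong (_+_ (length (f x))) (length-concatMap f xs))

Unique-concatMap : ∀ (f : A → List B) {xs} → Unique xs → (∀ {x} → x ∈ xs → Unique (f x)) →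
                   (∀ {x y z} → x ∈ xs → y ∈ xs → z ∈ f x → z ∈ f y → x ≡ y) → Unique (concatMap f xs)
Unique-concatMap f {[]}     _             _       _        = []
Unique-concatMap f {x ∷ xs} (x∉xs ∷ u) uniqueF disjoint =
  Uniqueₚ.++⁺ (uniqueF (here refl)) (Unique-concatMap f u (uniqueF ∘ there) λ x∈ y∈ → disjoint (there x∈) (there y∈))
    λ (z∈fx , z∈rest) → apart z∈fx z∈rest
  where
  apart : ∀ {z} → z ∈ f x → z ∈ concatMap f xs → ⊥
  apart z∈fx z∈rest with ∈ₚ.∈-concat⁻′ (map f xs) z∈rest
  ... | ys , z∈ys , ys∈ with ∈ₚ.∈-map⁻ f ys∈
  ... | y , y∈xs , refl = All.lookup x∉xs y∈xs (disjoint (here refl) (there y∈xs) z∈fx z∈ys)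

length-≤-Unique-⊆ : ∀ {xs ys : List A} → Unique xs → (∀ {x} → x ∈ xs → x ∈ ys) → length xs ≤ length ys
length-≤-Unique-⊆ {xs = []}     _             _   = z≤n
length-≤-Unique-⊆ {xs = x ∷ xs} (x∉xs ∷ u) xs⊆ys with ∈ₚ.∈-∃++ (xs⊆ys (here refl))
... | ys₁ , ys₂ , refl = ℕₚ.≤-trans (s≤s (length-≤-Unique-⊆ u xs⊆ys₁ys₂)) (ℕₚ.≤-reflexive (sym (Listₚ.length-++-sucʳ ys₁ x ys₂)))
  where
  xs⊆ys₁ys₂ : ∀ {y} → y ∈ xs → y ∈ ys₁ ++ ys₂
  xs⊆ys₁ys₂ y∈xs with ∈ₚ.∈-++⁻ ys₁ (xs⊆ys (there y∈xs))
  ... | inj₁ y∈ys₁        = ∈ₚ.∈-++⁺ˡ y∈ys₁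
  ... | inj₂ (here refl)  = ⊥-elim (All.lookup x∉xs y∈xs refl)
  ... | inj₂ (there y∈ys₂) = ∈ₚ.∈-++⁺ʳ ys₁ y∈ys₂

length-≡-Unique-⊆⊇ : ∀ {xs ys : List A} → Unique xs → Unique ys →
                     (∀ {x} → x ∈ xs → x ∈ ys) → (∀ {y} → y ∈ ys → y ∈ xs) → length xs ≡ length ys
length-≡-Unique-⊆⊇ uxs uys xs⊆ys ys⊆xs = ℕₚ.≤-antisym (length-≤-Unique-⊆ uxs xs⊆ys) (length-≤-Unique-⊆ uys ys⊆xs)

-- 0-based lookup with a default outside the range; `at` of Defs is the 1-based lookup on windows.
nth : A → Vec A n → ℕ → A
nth d []      _       = d
nth d (x ∷ v) zero    = x
nth d (x ∷ v) (suc c) = nth d v c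

infixl 10 _‼_
_‼_ : Exp n → ℕ → ℕ
_‼_ = nth 0

infixl 10 _‼ᶻ_
_‼ᶻ_ : Vec ℤ n → ℕ → ℤ
_‼ᶻ_ = nth (+ 0)

nth-outside : ∀ d (v : Vec A n) c → n ≤ c → nth d v c ≡ d
nth-outside d []      c       _         = refl
nth-outside d (x ∷ v) (suc c) (s≤s n≤c) = nth-outside d v c n≤c

nth-tabulate : ∀ d n (g : ℕ → A) c → c < n → nth d (tabulate {n = n} (g ∘ toℕ)) c ≡ g c
nth-tabulate d (suc n) g zero    _         = refl
nth-tabulate d (suc n) g (suc c) (s≤s c<n) = nth-tabulate d n (g ∘ suc) c c<n

nth-replicate : ∀ d n c → nth {A = A} d (replicate n d) c ≡ d
nth-replicate d zero    c       = refl
nth-replicate d (suc n) zero    = refl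
nth-replicate d (suc n) (suc c) = nth-replicate d n c

nth-ext : ∀ d (u v : Vec A n) → (∀ c → nth d u c ≡ nth d v c) → u ≡ v
nth-ext d []      []      _   = refl
nth-ext d (x ∷ u) (y ∷ v) u≗v = cong₂ _∷_ (u≗v zero) (nth-ext d u v (u≗v ∘ suc))

infix 4 _≤ᵛ_
_≤ᵛ_ : Exp n → Exp n → Set
u ≤ᵛ v = ∀ c → u ‼ c ≤ v ‼ c

infixl 6 _∸ᵛ_
_∸ᵛ_ : Exp n → Exp n → Exp n
_∸ᵛ_ = zipWith _∸_

‼-∸ᵛ : ∀ (u v : Exp n) c → (u ∸ᵛ v) ‼ c ≡ u ‼ c ∸ v ‼ c
‼-∸ᵛ []      []      c       = refl
‼-∸ᵛ (x ∷ u) (y ∷ v) zero    = refl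
‼-∸ᵛ (x ∷ u) (y ∷ v) (suc c) = ‼-∸ᵛ u v c

‼-scale : ∀ k (v : Exp n) c → scale k v ‼ c ≡ k * v ‼ c
‼-scale k []      c       = sym (ℕₚ.*-zeroʳ k)
‼-scale k (x ∷ v) zero    = refl
‼-scale k (x ∷ v) (suc c) = ‼-scale k v c

‼0≤sumℕ : ∀ (v : Exp n) → v ‼ 0 ≤ sumℕ v
‼0≤sumℕ []      = z≤n
‼0≤sumℕ (x ∷ v) = ℕₚ.m≤m+n x _

∈-below⁻ : ∀ (a b : Exp n) → b ∈ below a → b ≤ᵛ a
∈-below⁻ []      []      _    _ = z≤n
∈-below⁻ (x ∷ a) (y ∷ b) b∈ c with ∈ₚ.∈-concat⁻′ (map (λ i → map (i ∷_) (below a)) (upTo (suc x))) b∈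
... | bs , b∈bs , bs∈ with ∈ₚ.∈-map⁻ (λ i → map (i ∷_) (below a)) bs∈
... | i , i∈ , refl with ∈ₚ.∈-map⁻ (i ∷_) b∈bs | ∈ₚ.∈-applyUpTo⁻ (λ k → k) i∈
... | b′ , b′∈ , refl | _ , i<1+x , refl with c
...   | zero  = ℕₚ.≤-pred i<1+x
...   | suc c = ∈-below⁻ a b′ b′∈ c

∈-below⁺ : ∀ (a b : Exp n) → b ≤ᵛ a → b ∈ below a
∈-below⁺ []      []      _   = here refl
∈-below⁺ (x ∷ a) (y ∷ b) b≤a =
  ∈ₚ.∈-concat⁺′ (∈ₚ.∈-map⁺ (y ∷_) (∈-below⁺ a b (b≤a ∘ suc)))
                (∈ₚ.∈-map⁺ (λ i → map (i ∷_) (below a)) (∈ₚ.∈-applyUpTo⁺ (λ k → k) (s≤s (b≤a zero))))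

below-Unique : ∀ (a : Exp n) → Unique (below a)
below-Unique []      = [] ∷ []
below-Unique (x ∷ a) =
  Unique-concatMap (λ i → map (i ∷_) (below a)) (Uniqueₚ.upTo⁺ (suc x))
    (λ _ → Uniqueₚ.map⁺ (cong Vec.tail) (below-Unique a)) heads-agree
  where
  heads-agree : ∀ {i j b} → i ∈ upTo (suc x) → j ∈ upTo (suc x) →
                b ∈ map (i ∷_) (below a) → b ∈ map (j ∷_) (below a) → i ≡ j
  heads-agree _ _ b∈i b∈j with ∈ₚ.∈-map⁻ _ b∈i | ∈ₚ.∈-map⁻ _ b∈j
  ... | _ , _ , refl | _ , _ , eq = cong Vec.head eq

mono-≡ : ∀ (e : Exp n) → mono e e ≡ + 1
mono-≡ e = cong (if_then + 1 else + 0) (⌊⌋-true (≡-dec ℕ._≟_ e e) refl)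

mono-≢ : ∀ (e b : Exp n) → b ≢ e → mono e b ≡ + 0
mono-≢ e b b≢e = cong (if_then + 1 else + 0) (⌊⌋-false (≡-dec ℕ._≟_ b e) b≢e)

mono-⊛ : ∀ (e a : Exp n) (g : Series n) → e ≤ᵛ a → (mono e ⊛ g) a ≡ g (a ∸ᵛ e)
mono-⊛ e a g e≤a = begin
  sumℤ (map (λ b → mono e b ℤ.* g (a ∸ᵛ b)) (below a))
    ≡⟨ sumℤ-map-single _ e (below-Unique a) (∈-below⁺ a e e≤a)
         (λ {b} _ b≢e → cong (ℤ._* g (a ∸ᵛ b)) (mono-≢ e b b≢e)) ⟩
  mono e e ℤ.* g (a ∸ᵛ e)
    ≡⟨ cong (ℤ._* g (a ∸ᵛ e)) (mono-≡ e) ⟩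
  + 1 ℤ.* g (a ∸ᵛ e)
    ≡⟨ ℤₚ.*-identityˡ _ ⟩
  g (a ∸ᵛ e) ∎
  where open ≡-Reasoning

mono-⊛-0 : ∀ (e a : Exp n) (g : Series n) → (e ≤ᵛ a → g (a ∸ᵛ e) ≡ + 0) → (mono e ⊛ g) a ≡ + 0
mono-⊛-0 e a g g≡0 = sumℤ-map-0 _ (below a) term≡0
  where
  term≡0 : ∀ {b} → b ∈ below a → mono e b ℤ.* g (a ∸ᵛ b) ≡ + 0
  term≡0 {b} b∈ with ≡-dec ℕ._≟_ e b
  ... | yes refl = trans (cong (mono e e ℤ.*_) (g≡0 (∈-below⁻ a e b∈))) (ℤₚ.*-zeroʳ (mono e e))
  ... | no e≢b   = cong (ℤ._* g (a ∸ᵛ b)) (mono-≢ e b (e≢b ∘ sym))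

sumS-⊛ : ∀ (fs : List (Series n)) (g : Series n) a → (sumS fs ⊛ g) a ≡ sumℤ (map (λ f → (f ⊛ g) a) fs)
sumS-⊛ []       g a = sumℤ-map-0 _ (below a) (λ _ → refl)
sumS-⊛ (f ∷ fs) g a = begin
  sumℤ (map (λ b → (f b ℤ.+ sumS fs b) ℤ.* g (a ∸ᵛ b)) (below a))
    ≡⟨ cong sumℤ (Listₚ.map-cong (λ b → ℤₚ.*-distribʳ-+ (g (a ∸ᵛ b)) (f b) (sumS fs b)) (below a)) ⟩
  sumℤ (map (λ b → f b ℤ.* g (a ∸ᵛ b) ℤ.+ sumS fs b ℤ.* g (a ∸ᵛ b)) (below a))
    ≡⟨ sumℤ-map-+ (λ b → f b ℤ.* g (a ∸ᵛ b)) (λ b → sumS fs b ℤ.* g (a ∸ᵛ b)) (below a) ⟩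
  (f ⊛ g) a ℤ.+ (sumS fs ⊛ g) a
    ≡⟨ cong (λ s → (f ⊛ g) a ℤ.+ s) (sumS-⊛ fs g a) ⟩
  (f ⊛ g) a ℤ.+ sumℤ (map (λ f → (f ⊛ g) a) fs) ∎
  where open ≡-Reasoning

geomInv-scale : ∀ (p : Exp n) k → 0 < p ‼ 0 → geomInv p (scale k p) ≡ + 1
geomInv-scale p k 0<p₀ = cong +_ (length-filter≡1 (λ j → ≡-dec ℕ._≟_ (scale j p) (scale k p)) k
  (Uniqueₚ.upTo⁺ _) (∈ₚ.∈-applyUpTo⁺ (λ j → j) (s≤s k≤sum)) refl (λ {j} _ → scale-injective j))
  where
  instance _ = ℕ.>-nonZero 0<p₀
  k≤sum : k ≤ sumℕ (scale k p)
  k≤sum = ℕₚ.≤-trans (ℕₚ.m≤m*n k (p ‼ 0)) (ℕₚ.≤-trans (ℕₚ.≤-reflexive (sym (‼-scale k p 0))) (‼0≤sumℕ (scale k p)))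
  scale-injective : ∀ j → scale j p ≡ scale k p → j ≡ k
  scale-injective j eq = ℕₚ.*-cancelʳ-≡ j k (p ‼ 0)
    (trans (sym (‼-scale j p 0)) (trans (cong (_‼ 0) eq) (‼-scale k p 0)))

geomInv-*-0 : ∀ (p b : Exp n) t → (∀ k → scale k p ≡ b → t ≡ + 0) → geomInv p b ℤ.* t ≡ + 0
geomInv-*-0 p b t t≡0 with filter (λ k → ≡-dec ℕ._≟_ (scale k p) b) (upTo (suc (sumℕ b))) in eq
... | []     = refl
... | k ∷ ks = trans (cong (+ length (k ∷ ks) ℤ.*_) (t≡0 k kp≡b)) (ℤₚ.*-zeroʳ (+ length (k ∷ ks)))
  where
  kp≡b : scale k p ≡ b
  kp≡b = proj₂ (∈ₚ.∈-filter⁻ (λ k → ≡-dec ℕ._≟_ (scale k p) b) {xs = upTo (suc (sumℕ b))}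
                              (subst (k ∈_) (sym eq) (here refl)))

ins : ℕ → A → Vec A n → Vec A (suc n)
ins zero    x v       = x ∷ v
ins (suc p) x []      = x ∷ []
ins (suc p) x (y ∷ v) = y ∷ ins p x v

rem : ℕ → Vec A (suc n) → Vec A n
rem zero    (x ∷ v)     = v
rem (suc p) (x ∷ [])    = []
rem (suc p) (x ∷ y ∷ v) = x ∷ rem p (y ∷ v)

nth-ins-≡ : ∀ d x (v : Vec A n) {p} → p ≤ n → nth d (ins p x v) p ≡ x
nth-ins-≡ d x v       {zero}  _         = refl
nth-ins-≡ d x (y ∷ v) {suc p} (s≤s p≤n) = nth-ins-≡ d x v p≤n

nth-ins-< : ∀ d x (v : Vec A n) {p c} → p ≤ n → c < p → nth d (ins p x v) c ≡ nth d v c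
nth-ins-< d x (y ∷ v) {suc p} {zero}  _         _         = refl
nth-ins-< d x (y ∷ v) {suc p} {suc c} (s≤s p≤n) (s≤s c<p) = nth-ins-< d x v p≤n c<p

nth-ins-> : ∀ d x (v : Vec A n) {p c} → p ≤ c → nth d (ins p x v) (suc c) ≡ nth d v c
nth-ins-> d x v       {zero}  {c}     _         = refl
nth-ins-> d x []      {suc p} {suc c} _         = refl
nth-ins-> d x (y ∷ v) {suc p} {suc c} (s≤s p≤c) = nth-ins-> d x v p≤c

ins-rem : ∀ d (v : Vec A (suc n)) {p} → p ≤ n → ins p (nth d v p) (rem p v) ≡ v
ins-rem d (x ∷ v)     {zero}  _         = refl
ins-rem d (x ∷ y ∷ v) {suc p} (s≤s p≤n) = cong (x ∷_) (ins-rem d (y ∷ v) p≤n)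

rem-suc : ∀ p y (v : Vec A (suc n)) → rem (suc p) (y ∷ v) ≡ y ∷ rem p v
rem-suc p y (z ∷ v) = refl

rem-ins : ∀ x (v : Vec A n) {p} → p ≤ n → rem p (ins p x v) ≡ v
rem-ins x v       {zero}  _         = refl
rem-ins x (y ∷ v) {suc p} (s≤s p≤n) = trans (rem-suc p y (ins p x v)) (cong (y ∷_) (rem-ins x v p≤n))

nth-∈ : ∀ d (v : Vec A n) {c} → c < n → nth d v c ∈ toList v
nth-∈ d (x ∷ v) {zero}  _         = here refl
nth-∈ d (x ∷ v) {suc c} (s≤s c<n) = there (nth-∈ d v c<n)

∈-nth : ∀ d (v : Vec A n) {x} → x ∈ toList v → ∃ λ c → c < n × nth d v c ≡ x
∈-nth d (y ∷ v) (here refl) = zero , s≤s z≤n , refl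
∈-nth d (y ∷ v) (there x∈)  = let c , c<n , eq = ∈-nth d v x∈ in suc c , s≤s c<n , eq

Unique-nth-injective : ∀ d (f : A → B) (v : Vec A n) → Unique (map f (toList v)) →
                       ∀ {c c′} → c < n → c′ < n → f (nth d v c) ≡ f (nth d v c′) → c ≡ c′
Unique-nth-injective d f (x ∷ v) _           {zero}  {zero}   _         _          _  = refl
Unique-nth-injective d f (x ∷ v) (fx∉ ∷ _)  {zero}  {suc c′} _         (s≤s c′<n) eq =
  ⊥-elim (All.lookup fx∉ (∈ₚ.∈-map⁺ f (nth-∈ d v c′<n)) eq)
Unique-nth-injective d f (x ∷ v) (fx∉ ∷ _)  {suc c} {zero}   (s≤s c<n) _          eq =
  ⊥-elim (All.lookup fx∉ (∈ₚ.∈-map⁺ f (nth-∈ d v c<n)) (sym eq))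
Unique-nth-injective d f (x ∷ v) (_ ∷ u)    {suc c} {suc c′} (s≤s c<n) (s≤s c′<n) eq =
  cong suc (Unique-nth-injective d f v u c<n c′<n eq)

module _ {A B : Set} (dA : A) (dB : B) where

  Everywhere : (A → B → Set) → Vec A n → Vec B n → Set
  Everywhere {n} P u v = ∀ {c} → c < n → P (nth dA u c) (nth dB v c)

  Adjacent : (A → B → A → B → Set) → Vec A n → Vec B n → Set
  Adjacent {n} R u v = ∀ {c} → suc c < n → R (nth dA u c) (nth dB v c) (nth dA u (suc c)) (nth dB v (suc c))

  module _ {P : A → B → Set} where

    Everywhere-ins : ∀ p x y (u : Vec A n) (v : Vec B n) → P x y → Everywhere P u v →
                     Everywhere P (ins p x u) (ins p y v)
    Everywhere-ins zero    x y u       v       Pxy all {zero}  _         = Pxy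
    Everywhere-ins zero    x y u       v       Pxy all {suc c} (s≤s c<n) = all c<n
    Everywhere-ins (suc p) x y []      []      Pxy all {zero}  _         = Pxy
    Everywhere-ins (suc p) x y []      []      Pxy all {suc c} (s≤s ())
    Everywhere-ins (suc p) x y (_ ∷ u) (_ ∷ v) Pxy all {zero}  _         = all (s≤s z≤n)
    Everywhere-ins (suc p) x y (_ ∷ u) (_ ∷ v) Pxy all {suc c} (s≤s c<n) =
      Everywhere-ins p x y u v Pxy (all ∘ s≤s) c<n

    Everywhere-rem : ∀ p x y (u : Vec A n) (v : Vec B n) → p ≤ n →
                     Everywhere P (ins p x u) (ins p y v) → P x y × Everywhere P u v
    Everywhere-rem zero    x y u       v       _         all = all (s≤s z≤n) , all ∘ s≤s
    Everywhere-rem (suc p) x y (x₀ ∷ u) (y₀ ∷ v) (s≤s p≤n) all with Everywhere-rem p x y u v p≤n (all ∘ s≤s)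
    ... | Pxy , rest = Pxy , all′
      where
      all′ : Everywhere P (x₀ ∷ u) (y₀ ∷ v)
      all′ {zero}  _         = all (s≤s z≤n)
      all′ {suc c} (s≤s c<n) = rest c<n

  module _ {R : A → B → A → B → Set} where

    Adjacent-ins : ∀ p x y (u : Vec A n) (v : Vec B n) → p ≤ n → Adjacent R u v →
                   (0 < p → R (nth dA u (ℕ.pred p)) (nth dB v (ℕ.pred p)) x y) →
                   (p < n → R x y (nth dA u p) (nth dB v p)) →
                   Adjacent R (ins p x u) (ins p y v)
    Adjacent-ins zero x y u v _ _ _ right {zero} (s≤s 0<n) = right 0<n
    Adjacent-ins zero x y u v _ adj _ _ {suc c} (s≤s 1+c<n) = adj 1+c<n
    Adjacent-ins (suc zero) x y (_ ∷ u) (_ ∷ v) _ _ left _ {zero} _ = left (s≤s z≤n)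
    Adjacent-ins (suc (suc p)) x y (_ ∷ _ ∷ u) (_ ∷ _ ∷ v) _ adj _ _ {zero} _ = adj (s≤s (s≤s z≤n))
    Adjacent-ins (suc zero) x y (_ ∷ u) (_ ∷ v) (s≤s p≤n) adj left right {suc c} (s≤s 1+c<n) =
      Adjacent-ins zero x y u v p≤n (adj ∘ s≤s) (λ ()) (right ∘ s≤s) 1+c<n
    Adjacent-ins (suc (suc p)) x y (_ ∷ u) (_ ∷ v) (s≤s p≤n) adj left right {suc c} (s≤s 1+c<n) =
      Adjacent-ins (suc p) x y u v p≤n (adj ∘ s≤s) (λ _ → left (s≤s z≤n)) (right ∘ s≤s) 1+c<n

    Adjacent-rem : ∀ p x y (u : Vec A n) (v : Vec B n) → p ≤ n →
                   (∀ {a b a′ b′} → R a b x y → R x y a′ b′ → R a b a′ b′) →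
                   Adjacent R (ins p x u) (ins p y v) → Adjacent R u v
    Adjacent-rem zero x y u v _ _ adj = adj ∘ s≤s
    Adjacent-rem (suc zero) x y (_ ∷ _ ∷ u) (_ ∷ _ ∷ v) _ through adj {zero} _ =
      through (adj (s≤s (s≤s z≤n))) (adj (s≤s (s≤s (s≤s z≤n))))
    Adjacent-rem (suc (suc p)) x y (_ ∷ _ ∷ u) (_ ∷ _ ∷ v) _ _ adj {zero} _ = adj (s≤s (s≤s z≤n))
    Adjacent-rem (suc p) x y (_ ∷ u) (_ ∷ v) (s≤s p≤n) through adj {suc c} (s≤s 1+c<n) =
      Adjacent-rem p x y u v p≤n through (adj ∘ s≤s) 1+c<n

    Adjacent-ins-left : ∀ p x y (u : Vec A n) (v : Vec B n) → p ≤ n → Adjacent R (ins p x u) (ins p y v) →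
                        0 < p → R (nth dA u (ℕ.pred p)) (nth dB v (ℕ.pred p)) x y
    Adjacent-ins-left (suc zero)    x y (_ ∷ u) (_ ∷ v) _         adj _ = adj (s≤s (s≤s z≤n))
    Adjacent-ins-left (suc (suc p)) x y (_ ∷ u) (_ ∷ v) (s≤s p≤n) adj _ =
      Adjacent-ins-left (suc p) x y u v p≤n (adj ∘ s≤s) (s≤s z≤n)

    Adjacent-ins-right : ∀ p x y (u : Vec A n) (v : Vec B n) → p ≤ n → Adjacent R (ins p x u) (ins p y v) →
                         p < n → R x y (nth dA u p) (nth dB v p)
    Adjacent-ins-right zero    x y (_ ∷ u) (_ ∷ v) _         adj _         = adj (s≤s (s≤s z≤n))
    Adjacent-ins-right (suc p) x y (_ ∷ u) (_ ∷ v) (s≤s p≤n) adj (s≤s p<n) =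
      Adjacent-ins-right p x y u v p≤n (adj ∘ s≤s) p<n

antitone : ∀ (h : ℕ → ℕ) → (∀ c → h (suc c) ≤ h c) → ∀ {c d} → c ≤ d → h d ≤ h c
antitone h step {c} {d} c≤d with ℕₚ.m≤n⇒m<n∨m≡n c≤d
... | inj₂ refl          = ℕₚ.≤-refl
... | inj₁ (s≤s c≤d-1) = ℕₚ.≤-trans (step _) (antitone h step c≤d-1)

-- The product of the geometric series

sqPrefix-‼-< : ∀ n {i c} → c < i → c < n → sqPrefix n i ‼ c ≡ 2
sqPrefix-‼-< n {i} {c} c<i c<n =
  trans (nth-tabulate 0 n (λ j → if ⌊ j ℕ.<? i ⌋ then 2 else 0) c c<n)
        (cong (if_then 2 else 0) (⌊⌋-true (c ℕ.<? i) c<i))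

sqPrefix-‼-≥ : ∀ n {i c} → i ≤ c → sqPrefix n i ‼ c ≡ 0
sqPrefix-‼-≥ n {i} {c} i≤c with ℕₚ.<-≤-connex c n
... | inj₁ c<n = trans (nth-tabulate 0 n (λ j → if ⌊ j ℕ.<? i ⌋ then 2 else 0) c c<n)
                       (cong (if_then 2 else 0) (⌊⌋-false (c ℕ.<? i) (ℕₚ.≤⇒≯ i≤c)))
... | inj₂ n≤c = nth-outside 0 (sqPrefix n i) c n≤c

-- For 1 ≤ i ≤ n + 1: the exponents occurring in Π_{i ≤ j ≤ n} (1 − q_1²⋯q_j²)⁻¹, each with coefficient 1.
record Staircase (i : ℕ) (b : Exp n) : Set where
  field
    height          : ℕ → ℕ
    ‼≡2*height      : ∀ c → b ‼ c ≡ 2 * height c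
    height-antitone : ∀ c → height (suc c) ≤ height c
    height-flat     : ∀ c → height c ≡ height (c ⊔ ℕ.pred i)

zero-Staircase : ∀ n i → Staircase i (replicate n 0)
zero-Staircase n i = record
  { height = λ _ → 0 ; ‼≡2*height = nth-replicate 0 n ; height-antitone = λ _ → z≤n ; height-flat = λ _ → refl }

Staircase-top : ∀ (b : Exp n) → Staircase (suc n) b → b ≡ replicate n 0
Staircase-top {n} b s = nth-ext 0 b (replicate n 0) λ c → trans (b‼c≡0 c) (sym (nth-replicate 0 n c))
  where
  open Staircase s
  height-n : height n ≡ 0
  height-n = ℕₚ.*-cancelˡ-≡ (height n) 0 2 (trans (sym (‼≡2*height n)) (nth-outside 0 b n ℕₚ.≤-refl))
  b‼c≡0 : ∀ c → b ‼ c ≡ 0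
  b‼c≡0 c with ℕₚ.<-≤-connex c n
  ... | inj₂ n≤c = nth-outside 0 b c n≤c
  ... | inj₁ c<n = begin
    b ‼ c                ≡⟨ ‼≡2*height c ⟩
    2 * height c         ≡⟨ cong (2 *_) (height-flat c) ⟩
    2 * height (c ⊔ n)   ≡⟨ cong (λ d → 2 * height d) (ℕₚ.m≤n⇒m⊔n≡n (ℕₚ.<⇒≤ c<n)) ⟩
    2 * height n         ≡⟨ cong (2 *_) height-n ⟩
    0                    ∎
    where open ≡-Reasoning

module Peel {n i′ : ℕ} (i≤n : suc i′ ≤ n) (b : Exp n) where

  private
    i : ℕ
    i = suc i′

  p : Exp n
  p = sqPrefix n i

  p‼< : ∀ {c} → c < i → p ‼ c ≡ 2
  p‼< c<i = sqPrefix-‼-< n c<i (ℕₚ.<-≤-trans c<i i≤n)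

  kp‼< : ∀ k {c} → c < i → scale k p ‼ c ≡ k * 2
  kp‼< k c<i = trans (‼-scale k p _) (cong (k *_) (p‼< c<i))

  kp‼≥ : ∀ k {c} → i ≤ c → scale k p ‼ c ≡ 0
  kp‼≥ k i≤c = trans (‼-scale k p _) (trans (cong (k *_) (sqPrefix-‼-≥ n i≤c)) (ℕₚ.*-zeroʳ k))

  rest‼< : ∀ k {c} → c < i → (b ∸ᵛ scale k p) ‼ c ≡ b ‼ c ∸ k * 2
  rest‼< k {c} c<i = trans (‼-∸ᵛ b (scale k p) c) (cong (b ‼ c ∸_) (kp‼< k c<i))

  rest‼≥ : ∀ k {c} → i ≤ c → (b ∸ᵛ scale k p) ‼ c ≡ b ‼ c
  rest‼≥ k {c} i≤c = trans (‼-∸ᵛ b (scale k p) c) (cong (b ‼ c ∸_) (kp‼≥ k i≤c))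

  b‼<≡rest+2k : ∀ k → scale k p ≤ᵛ b → ∀ {c} → c < i → b ‼ c ≡ (b ∸ᵛ scale k p) ‼ c + k * 2
  b‼<≡rest+2k k kp≤b {c} c<i = begin
    b ‼ c                       ≡⟨ ℕₚ.m∸n+n≡m (subst (_≤ b ‼ c) (kp‼< k c<i) (kp≤b c)) ⟨
    b ‼ c ∸ k * 2 + k * 2       ≡⟨ cong (_+ k * 2) (rest‼< k c<i) ⟨
    (b ∸ᵛ scale k p) ‼ c + k * 2 ∎
    where open ≡-Reasoning

  peel : Staircase i b → ∃ λ k → scale k p ≤ᵛ b × Staircase (suc i) (b ∸ᵛ scale k p)
  peel s = k , kp≤b , record
    { height          = height ∘ (_⊔ i)
    ; ‼≡2*height      = rest≡2*height
    ; height-antitone = λ c → antitone height height-antitone (ℕₚ.⊔-monoˡ-≤ i (ℕₚ.n≤1+n c))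
    ; height-flat     = λ c → cong height (sym (trans (ℕₚ.⊔-assoc c i i) (cong (c ⊔_) (ℕₚ.⊔-idem i))))
    }
    where
    open Staircase s
    k : ℕ
    k = height i′ ∸ height i
    height-< : ∀ {c} → c < i → height c ≡ height i′
    height-< (s≤s c≤i′) = trans (height-flat _) (cong height (ℕₚ.m≤n⇒m⊔n≡n c≤i′))
    kp≤b : scale k p ≤ᵛ b
    kp≤b c with ℕₚ.<-≤-connex c i
    ... | inj₂ i≤c = ℕₚ.≤-trans (ℕₚ.≤-reflexive (kp‼≥ k i≤c)) z≤n
    ... | inj₁ c<i = begin
      scale k p ‼ c     ≡⟨ kp‼< k c<i ⟩
      k * 2             ≤⟨ ℕₚ.*-monoˡ-≤ 2 (ℕₚ.m∸n≤m (height i′) (height i)) ⟩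
      height i′ * 2     ≡⟨ ℕₚ.*-comm (height i′) 2 ⟩
      2 * height i′     ≡⟨ cong (2 *_) (height-< c<i) ⟨
      2 * height c      ≡⟨ ‼≡2*height c ⟨
      b ‼ c             ∎
      where open ℕₚ.≤-Reasoning
    rest≡2*height : ∀ c → (b ∸ᵛ scale k p) ‼ c ≡ 2 * height (c ⊔ i)
    rest≡2*height c with ℕₚ.<-≤-connex c i
    ... | inj₂ i≤c = trans (rest‼≥ k i≤c) (trans (‼≡2*height c) (cong (λ d → 2 * height d) (sym (ℕₚ.m≥n⇒m⊔n≡m i≤c))))
    ... | inj₁ c<i = begin
      (b ∸ᵛ scale k p) ‼ c          ≡⟨ rest‼< k c<i ⟩
      b ‼ c ∸ k * 2                 ≡⟨ cong₂ _∸_ (trans (‼≡2*height c) (cong (2 *_) (height-< c<i))) (ℕₚ.*-comm k 2) ⟩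
      2 * height i′ ∸ 2 * k         ≡⟨ ℕₚ.*-distribˡ-∸ 2 (height i′) k ⟨
      2 * (height i′ ∸ k)           ≡⟨ cong (2 *_) (ℕₚ.m∸[m∸n]≡n (height-antitone i′)) ⟩
      2 * height i                  ≡⟨ cong (λ d → 2 * height d) (ℕₚ.m≤n⇒m⊔n≡n (ℕₚ.<⇒≤ c<i)) ⟨
      2 * height (c ⊔ i)            ∎
      where open ≡-Reasoning

  module Unpeel (k : ℕ) (kp≤b : scale k p ≤ᵛ b) (s : Staircase (suc i) (b ∸ᵛ scale k p)) where

    open Staircase s

    height′ : ℕ → ℕ
    height′ c = if ⌊ c ℕ.<? i ⌋ then height c + k else height c
    height′-< : ∀ {c} → c < i → height′ c ≡ height c + k
    height′-< {c} c<i = cong (if_then height c + k else height c) (⌊⌋-true (c ℕ.<? i) c<i)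
    height′-≥ : ∀ {c} → i ≤ c → height′ c ≡ height c
    height′-≥ {c} i≤c = cong (if_then height c + k else height c) (⌊⌋-false (c ℕ.<? i) (ℕₚ.≤⇒≯ i≤c))
    height-≤i : ∀ {c} → c ≤ i → height c ≡ height i
    height-≤i c≤i = trans (height-flat _) (cong height (ℕₚ.m≤n⇒m⊔n≡n c≤i))
    b≡2*height′ : ∀ c → b ‼ c ≡ 2 * height′ c
    b≡2*height′ c with ℕₚ.<-≤-connex c i
    ... | inj₂ i≤c = trans (sym (rest‼≥ k i≤c)) (trans (‼≡2*height c) (cong (2 *_) (sym (height′-≥ i≤c))))
    ... | inj₁ c<i = begin
      b ‼ c                           ≡⟨ b‼<≡rest+2k k kp≤b c<i ⟩
      (b ∸ᵛ scale k p) ‼ c + k * 2    ≡⟨ cong₂ _+_ (‼≡2*height c) (ℕₚ.*-comm k 2) ⟩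
      2 * height c + 2 * k            ≡⟨ ℕₚ.*-distribˡ-+ 2 (height c) k ⟨
      2 * (height c + k)              ≡⟨ cong (2 *_) (height′-< c<i) ⟨
      2 * height′ c                   ∎
      where open ≡-Reasoning
    antitone′ : ∀ c → height′ (suc c) ≤ height′ c
    antitone′ c with ℕₚ.<-≤-connex (suc c) i | ℕₚ.<-≤-connex c i
    ... | inj₁ 1+c<i | inj₁ c<i = subst₂ _≤_ (sym (height′-< 1+c<i)) (sym (height′-< c<i))
                                         (ℕₚ.+-monoˡ-≤ k (height-antitone c))
    ... | inj₁ 1+c<i | inj₂ i≤c = ⊥-elim (ℕₚ.<-asym 1+c<i (s≤s i≤c))
    ... | inj₂ i≤1+c | inj₁ c<i = subst₂ _≤_ (sym (height′-≥ i≤1+c)) (sym (height′-< c<i))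
                                         (ℕₚ.≤-trans (height-antitone c) (ℕₚ.m≤m+n (height c) k))
    ... | inj₂ i≤1+c | inj₂ i≤c = subst₂ _≤_ (sym (height′-≥ i≤1+c)) (sym (height′-≥ i≤c)) (height-antitone c)
    flat′ : ∀ c → height′ c ≡ height′ (c ⊔ i′)
    flat′ c with ℕₚ.<-≤-connex c i
    ... | inj₂ i≤c = cong height′ (sym (ℕₚ.m≥n⇒m⊔n≡m (ℕₚ.<⇒≤ i≤c)))
    ... | inj₁ (s≤s c≤i′) = begin
      height′ c          ≡⟨ height′-< (s≤s c≤i′) ⟩
      height c + k       ≡⟨ cong (_+ k) (trans (height-≤i (ℕₚ.m≤n⇒m≤1+n c≤i′)) (sym (height-≤i (ℕₚ.n≤1+n i′)))) ⟩
      height i′ + k      ≡⟨ height′-< ℕₚ.≤-refl ⟨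
      height′ i′         ≡⟨ cong height′ (ℕₚ.m≤n⇒m⊔n≡n c≤i′) ⟨
      height′ (c ⊔ i′)   ∎
      where open ≡-Reasoning

    staircase : Staircase i b
    staircase = record
      { height = height′ ; ‼≡2*height = b≡2*height′ ; height-antitone = antitone′ ; height-flat = flat′ }

  unpeel : ∀ k → scale k p ≤ᵛ b → Staircase (suc i) (b ∸ᵛ scale k p) → Staircase i b
  unpeel = Unpeel.staircase

  b‼i′≡b‼i+2k : ∀ k → scale k p ≤ᵛ b → Staircase (suc i) (b ∸ᵛ scale k p) → b ‼ i′ ≡ b ‼ i + k * 2
  b‼i′≡b‼i+2k k kp≤b s = begin
    b ‼ i′                          ≡⟨ b‼<≡rest+2k k kp≤b ℕₚ.≤-refl ⟩
    (b ∸ᵛ scale k p) ‼ i′ + k * 2   ≡⟨ cong (_+ k * 2) rest‼i′≡rest‼i ⟩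
    (b ∸ᵛ scale k p) ‼ i + k * 2    ≡⟨ cong (_+ k * 2) (rest‼≥ k ℕₚ.≤-refl) ⟩
    b ‼ i + k * 2                   ∎
    where
    open ≡-Reasoning
    open Staircase s
    rest‼i′≡rest‼i : (b ∸ᵛ scale k p) ‼ i′ ≡ (b ∸ᵛ scale k p) ‼ i
    rest‼i′≡rest‼i = begin
      (b ∸ᵛ scale k p) ‼ i′   ≡⟨ ‼≡2*height i′ ⟩
      2 * height i′           ≡⟨ cong (2 *_) (height-flat i′) ⟩
      2 * height (i′ ⊔ i)     ≡⟨ cong (λ d → 2 * height d) (ℕₚ.m≤n⇒m⊔n≡n (ℕₚ.n≤1+n i′)) ⟩
      2 * height i            ≡⟨ ‼≡2*height i ⟨
      (b ∸ᵛ scale k p) ‼ i    ∎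

  peel-unique : ∀ k₁ k₂ → scale k₁ p ≤ᵛ b → Staircase (suc i) (b ∸ᵛ scale k₁ p) →
                scale k₂ p ≤ᵛ b → Staircase (suc i) (b ∸ᵛ scale k₂ p) → k₁ ≡ k₂
  peel-unique k₁ k₂ le₁ s₁ le₂ s₂ = ℕₚ.*-cancelʳ-≡ k₁ k₂ 2
    (ℕₚ.+-cancelˡ-≡ (b ‼ i) _ _ (trans (sym (b‼i′≡b‼i+2k k₁ le₁ s₁)) (b‼i′≡b‼i+2k k₂ le₂ s₂)))

geomProd : (n i m : ℕ) → Series n
geomProd n i m = prodS (map (λ j → geomInv (sqPrefix n j)) (applyUpTo (_+_ i) m))

geomProd-suc : ∀ n i m → geomProd n i (suc m) ≡ geomInv (sqPrefix n i) ⊛ geomProd n (suc i) m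
geomProd-suc n i m = cong₂ (λ j js → geomInv (sqPrefix n j) ⊛ prodS (map (λ j → geomInv (sqPrefix n j)) js))
  (ℕₚ.+-identityʳ i)
  (trans (sym (Listₚ.map-upTo _ m)) (trans (Listₚ.map-cong (ℕₚ.+-suc i) (upTo m)) (Listₚ.map-upTo _ m)))

geomProd-coeff : ∀ n m i → 1 ≤ i → i + m ≡ suc n → ∀ b →
                 (Staircase i b → geomProd n i m b ≡ + 1) × (¬ Staircase i b → geomProd n i m b ≡ + 0)
geomProd-coeff n zero i _ i+0≡1+n b rewrite trans (sym (ℕₚ.+-identityʳ i)) i+0≡1+n =
  (λ s → trans (cong (mono (replicate n 0)) (Staircase-top b s)) (mono-≡ (replicate n 0))) ,
  (λ ¬s → mono-≢ (replicate n 0) b λ { refl → ¬s (zero-Staircase n (suc n)) })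
geomProd-coeff n (suc m) (suc i′) _ i+1+m≡1+n b =
  (λ s → trans unfold (present s)) , (λ ¬s → trans unfold (absent ¬s))
  where
  i : ℕ
  i = suc i′
  i+m≡n : i + m ≡ n
  i+m≡n = ℕₚ.suc-injective (trans (sym (ℕₚ.+-suc i m)) i+1+m≡1+n)
  open Peel {n} {i′} (subst (i ≤_) i+m≡n (ℕₚ.m≤m+n i m)) b
  rest : Series n
  rest = geomProd n (suc i) m
  unfold : geomProd n i (suc m) b ≡ (geomInv p ⊛ rest) b
  unfold = cong (λ f → f b) (geomProd-suc n i m)
  rest-coeff : ∀ b′ → (Staircase (suc i) b′ → rest b′ ≡ + 1) × (¬ Staircase (suc i) b′ → rest b′ ≡ + 0)
  rest-coeff = geomProd-coeff n m (suc i) (s≤s z≤n) (trans (sym (ℕₚ.+-suc i m)) i+1+m≡1+n)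
  present : Staircase i b → (geomInv p ⊛ rest) b ≡ + 1
  present s with peel s
  ... | k , kp≤b , s′ = begin
    (geomInv p ⊛ rest) b
      ≡⟨ sumℤ-map-single _ (scale k p) (below-Unique b) (∈-below⁺ b (scale k p) kp≤b) other-terms ⟩
    geomInv p (scale k p) ℤ.* rest (b ∸ᵛ scale k p)
      ≡⟨ cong₂ ℤ._*_ (geomInv-scale p k (subst (0 <_) (sym (p‼< (s≤s z≤n))) (s≤s z≤n))) (proj₁ (rest-coeff _) s′) ⟩
    + 1 ∎
    where
    open ≡-Reasoning
    other-terms : ∀ {c} → c ∈ below b → c ≢ scale k p → geomInv p c ℤ.* rest (b ∸ᵛ c) ≡ + 0
    other-terms {c} c∈ c≢kp = geomInv-*-0 p c _ λ where
      j refl → proj₂ (rest-coeff _) λ s″ → c≢kp (cong (λ j → scale j p) (peel-unique j k (∈-below⁻ b c c∈) s″ kp≤b s′))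
  absent : ¬ Staircase i b → (geomInv p ⊛ rest) b ≡ + 0
  absent ¬s = sumℤ-map-0 _ (below b) λ {c} c∈ → geomInv-*-0 p c _ λ where
    j refl → proj₂ (rest-coeff _) λ s″ → ¬s (unpeel j (∈-below⁻ b c c∈) s″)

-- Compatible signed permutations

𝟙[_<ᶻ_] : ℤ → ℤ → ℕ
𝟙[ s <ᶻ t ] = indicator ⌊ s ℤ.<? t ⌋

𝟙[<ᶻ]≤1 : ∀ s t → 𝟙[ s <ᶻ t ] ≤ 1
𝟙[<ᶻ]≤1 s t with ⌊ s ℤ.<? t ⌋
... | true  = ℕₚ.≤-refl
... | false = z≤n

mod2 : ℕ → ℕ
mod2 zero          = 0
mod2 (suc zero)    = 1
mod2 (suc (suc x)) = mod2 x

mod2≤1 : ∀ x → mod2 x ≤ 1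
mod2≤1 zero          = z≤n
mod2≤1 (suc zero)    = ℕₚ.≤-refl
mod2≤1 (suc (suc x)) = mod2≤1 x

halve-mod2 : ∀ x → x ≡ 2 * ⌊ x /2⌋ + mod2 x
halve-mod2 zero          = refl
halve-mod2 (suc zero)    = refl
halve-mod2 (suc (suc x)) = trans (cong (suc ∘ suc) (halve-mod2 x)) (cong (_+ mod2 x) (sym (ℕₚ.*-suc 2 ⌊ x /2⌋)))

halve-mod2-unique : ∀ q r → r ≤ 1 → ⌊ 2 * q + r /2⌋ ≡ q × mod2 (2 * q + r) ≡ r
halve-mod2-unique zero    zero       _ = refl , refl
halve-mod2-unique zero    (suc zero) _ = refl , refl
halve-mod2-unique zero    (suc (suc r)) (s≤s ())
halve-mod2-unique (suc q) r r≤1 rewrite ℕₚ.+-suc q (q + 0) =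
  let ⌊⌋≡q , mod2≡r = halve-mod2-unique q r r≤1 in cong suc ⌊⌋≡q , mod2≡r

SignFits : ℕ → ℤ → Set
SignFits x s = 𝟙[ s <ᶻ + 0 ] ≡ mod2 x

StepFits : ℕ → ℤ → ℕ → ℤ → Set
StepFits x s y t = ⌊ y /2⌋ + 𝟙[ t <ᶻ s ] ≤ ⌊ x /2⌋

Compatible : Exp n → Vec ℤ n → Set
Compatible a σ = Everywhere 0 (+ 0) SignFits a σ × Adjacent 0 (+ 0) StepFits a σ

compatible? : ∀ (a : Exp n) σ → Dec (Compatible a σ)
compatible? {n} a σ =
  ℕₚ.allUpTo? (λ c → 𝟙[ σ ‼ᶻ c <ᶻ + 0 ] ℕ.≟ mod2 (a ‼ c)) n ×-dec
  map′ (λ steps {c} 1+c<n → steps (ℕₚ.<-trans (ℕₚ.n<1+n c) 1+c<n) 1+c<n) (λ steps {c} _ → steps {c})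
       (ℕₚ.allUpTo? (λ c → suc c ℕ.<? n →-dec (⌊ a ‼ suc c /2⌋ + 𝟙[ σ ‼ᶻ suc c <ᶻ σ ‼ᶻ c ] ℕ.≤? ⌊ a ‼ c /2⌋)) n)

indicator-≤-split : ∀ i j → indicator (does (i ℕ.≤? j)) ≡ indicator (does (suc i ℕ.≤? j)) + indicator (does (j ℕ.≟ i))
indicator-≤-split i j with ℕₚ.<-cmp i j
... | tri< i<j i≢j _ rewrite dec-true (i ℕ.≤? j) (ℕₚ.<⇒≤ i<j) | dec-true (suc i ℕ.≤? j) i<j
                           | dec-false (j ℕ.≟ i) (i≢j ∘ sym) = refl
... | tri≈ _ refl _ rewrite dec-true (i ℕ.≤? i) ℕₚ.≤-refl | dec-false (suc i ℕ.≤? i) (ℕₚ.n≮n i)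
                          | dec-true (i ℕ.≟ i) refl = refl
... | tri> _ _ j<i rewrite dec-false (i ℕ.≤? j) (ℕₚ.<⇒≱ j<i) | dec-false (suc i ℕ.≤? j) (ℕₚ.<⇒≱ (ℕₚ.m<n⇒m<1+n j<i))
                        | dec-false (j ℕ.≟ i) (ℕₚ.<⇒≢ j<i) = refl

length-filter-≤-split : ∀ i js → length (filter (i ℕ.≤?_) js) ≡ length (filter (suc i ℕ.≤?_) js) + length (filter (ℕ._≟ i) js)
length-filter-≤-split i js = begin
  length (filter (i ℕ.≤?_) js)
    ≡⟨ length-filter≡sum (i ℕ.≤?_) js ⟩
  sum (map (λ j → indicator (does (i ℕ.≤? j))) js)
    ≡⟨ cong sum (Listₚ.map-cong (indicator-≤-split i) js) ⟩
  sum (map (λ j → indicator (does (suc i ℕ.≤? j)) + indicator (does (j ℕ.≟ i))) js)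
    ≡⟨ sum-map-+ _ _ js ⟩
  sum (map (λ j → indicator (does (suc i ℕ.≤? j))) js) + sum (map (λ j → indicator (does (j ℕ.≟ i))) js)
    ≡⟨ cong₂ _+_ (length-filter≡sum (suc i ℕ.≤?_) js) (length-filter≡sum (ℕ._≟ i) js) ⟨
  length (filter (suc i ℕ.≤?_) js) + length (filter (ℕ._≟ i) js) ∎
  where open ≡-Reasoning

at-suc : ∀ (σ : Vec ℤ n) c → at σ (suc c) ≡ σ ‼ᶻ c
at-suc []      c       = refl
at-suc (x ∷ σ) zero    = refl
at-suc (x ∷ σ) (suc c) = at-suc σ c

module Descents {n : ℕ} (σ : Vec ℤ n) where

  -- D c = d_{c+1}(σ) and δ c = [c + 1 ∈ Des(σ)] in the 0-based indexing used here.
  D : ℕ → ℕ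
  D c = dstat σ (suc c)

  δ : ℕ → ℕ
  δ c = 𝟙[ σ ‼ᶻ suc c <ᶻ σ ‼ᶻ c ]

  private
    descent? : Decidable (λ j → at σ (suc j) ℤ.< at σ j)
    descent? j = at σ (suc j) ℤ.<? at σ j
    positions : List ℕ
    positions = map suc (upTo (n ∸ 1))

  ∈-positions⁻ : ∀ {j} → j ∈ positions → j < n
  ∈-positions⁻ j∈ with ∈ₚ.∈-map⁻ suc j∈
  ... | _ , k∈ , refl with ∈ₚ.∈-applyUpTo⁻ (λ k → k) k∈
  ... | _ , k<n∸1 , refl = suc-< n k<n∸1
    where
    suc-< : ∀ n {k} → k < n ∸ 1 → suc k < n
    suc-< (suc n) k<n = s≤s k<n

  ∈-positions⁺ : ∀ {c} → suc c < n → suc c ∈ positions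
  ∈-positions⁺ {c} (s≤s c<n∸1) = ∈ₚ.∈-map⁺ suc (∈ₚ.∈-applyUpTo⁺ (λ k → k) c<n∸1)

  D-last : ∀ c → n ≤ suc c → D c ≡ 0
  D-last c n≤1+c = cong length (Listₚ.filter-none (suc c ℕ.≤?_) (All.tabulate λ j∈ 1+c≤j →
    ℕₚ.<-irrefl refl (ℕₚ.≤-trans (∈-positions⁻ (proj₁ (∈ₚ.∈-filter⁻ descent? {xs = positions} j∈))) (ℕₚ.≤-trans n≤1+c 1+c≤j))))

  D-step : ∀ c → suc c < n → D c ≡ δ c + D (suc c)
  D-step c 1+c<n = trans (length-filter-≤-split (suc c) (Des σ)) (trans (ℕₚ.+-comm (D (suc c)) _) (cong (_+ D (suc c)) count))
    where
    count : length (filter (ℕ._≟ suc c) (Des σ)) ≡ δ c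
    count with descent? (suc c)
    ... | yes desc = trans
      (length-filter≡1 (ℕ._≟ suc c) (suc c) (Uniqueₚ.filter⁺ descent? (Uniqueₚ.map⁺ ℕₚ.suc-injective (Uniqueₚ.upTo⁺ (n ∸ 1))))
                       (∈ₚ.∈-filter⁺ descent? (∈-positions⁺ 1+c<n) desc) refl (λ _ eq → eq))
      (sym (cong indicator (⌊⌋-true (σ ‼ᶻ suc c ℤ.<? σ ‼ᶻ c) (subst₂ ℤ._<_ (at-suc σ (suc c)) (at-suc σ c) desc))))
    ... | no ¬desc = trans
      (cong length (Listₚ.filter-none (ℕ._≟ suc c) (All.tabulate λ { j∈ refl → ¬desc (proj₂ (∈ₚ.∈-filter⁻ descent? {xs = positions} j∈)) })))
      (sym (cong indicator (⌊⌋-false (σ ‼ᶻ suc c ℤ.<? σ ‼ᶻ c) (¬desc ∘ subst₂ ℤ._<_ (sym (at-suc σ (suc c))) (sym (at-suc σ c))))))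

  sigmaExp-‼ : ∀ {c} → c < n → sigmaExp σ ‼ c ≡ 2 * D c + 𝟙[ σ ‼ᶻ c <ᶻ + 0 ]
  sigmaExp-‼ {c} c<n = trans (nth-tabulate 0 n (λ c → 2 * dstat σ (suc c) + eps σ (suc c)) c c<n)
                             (cong (λ s → 2 * D c + 𝟙[ s <ᶻ + 0 ]) (at-suc σ c))

module CompatibleStaircase {n : ℕ} (a : Exp n) (σ : Vec ℤ n) where

  open Descents σ

  private
    e : Exp n
    e = sigmaExp σ
    ε : ℕ → ℕ
    ε c = 𝟙[ σ ‼ᶻ c <ᶻ + 0 ]

  D≤half : Adjacent 0 (+ 0) StepFits a σ → ∀ c → D c ≤ ⌊ a ‼ c /2⌋
  D≤half steps c = D≤half-from n c (ℕₚ.m≤n+m n c)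
    where
    D≤half-from : ∀ k c → n ≤ c + k → D c ≤ ⌊ a ‼ c /2⌋
    D≤half-from k c n≤c+k with ℕₚ.<-≤-connex (suc c) n
    ... | inj₂ n≤1+c = ℕₚ.≤-trans (ℕₚ.≤-reflexive (D-last c n≤1+c)) z≤n
    D≤half-from zero c n≤c+0 | inj₁ 1+c<n =
      ⊥-elim (ℕₚ.<⇒≱ 1+c<n (ℕₚ.m≤n⇒m≤1+n (subst (n ≤_) (ℕₚ.+-identityʳ c) n≤c+0)))
    D≤half-from (suc k) c n≤c+1+k | inj₁ 1+c<n = begin
      D c                          ≡⟨ D-step c 1+c<n ⟩
      δ c + D (suc c)              ≤⟨ ℕₚ.+-monoʳ-≤ (δ c) (D≤half-from k (suc c) (subst (n ≤_) (ℕₚ.+-suc c k) n≤c+1+k)) ⟩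
      δ c + ⌊ a ‼ suc c /2⌋        ≡⟨ ℕₚ.+-comm (δ c) _ ⟩
      ⌊ a ‼ suc c /2⌋ + δ c        ≤⟨ steps 1+c<n ⟩
      ⌊ a ‼ c /2⌋                  ∎
      where open ℕₚ.≤-Reasoning

  compatible⇒staircase : Compatible a σ → e ≤ᵛ a × Staircase 1 (a ∸ᵛ e)
  compatible⇒staircase (signs , steps) = e≤a , record
    { height          = height
    ; ‼≡2*height      = ‼≡2*height
    ; height-antitone = height-antitone
    ; height-flat     = λ c → cong height (sym (ℕₚ.⊔-identityʳ c))
    }
    where
    e‼ : ∀ {c} → c < n → e ‼ c ≡ 2 * D c + mod2 (a ‼ c)
    e‼ {c} c<n = trans (sigmaExp-‼ c<n) (cong (_+_ (2 * D c)) (signs c<n))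
    e≤a : e ≤ᵛ a
    e≤a c with ℕₚ.<-≤-connex c n
    ... | inj₂ n≤c = ℕₚ.≤-trans (ℕₚ.≤-reflexive (nth-outside 0 e c n≤c)) z≤n
    ... | inj₁ c<n = begin
      e ‼ c                              ≡⟨ e‼ c<n ⟩
      2 * D c + mod2 (a ‼ c)             ≤⟨ ℕₚ.+-monoˡ-≤ (mod2 (a ‼ c)) (ℕₚ.*-monoʳ-≤ 2 (D≤half steps c)) ⟩
      2 * ⌊ a ‼ c /2⌋ + mod2 (a ‼ c)     ≡⟨ halve-mod2 (a ‼ c) ⟨
      a ‼ c                              ∎
      where open ℕₚ.≤-Reasoning
    height : ℕ → ℕ
    height c = ⌊ a ‼ c /2⌋ ∸ D c
    ‼≡2*height : ∀ c → (a ∸ᵛ e) ‼ c ≡ 2 * height c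
    ‼≡2*height c with ℕₚ.<-≤-connex c n
    ... | inj₂ n≤c rewrite ‼-∸ᵛ a e c | nth-outside 0 e c n≤c | nth-outside 0 a c n≤c | ℕₚ.0∸n≡0 (D c) = refl
    ... | inj₁ c<n = begin
      (a ∸ᵛ e) ‼ c                                          ≡⟨ ‼-∸ᵛ a e c ⟩
      a ‼ c ∸ e ‼ c                                         ≡⟨ cong₂ _∸_ (halve-mod2 (a ‼ c)) (e‼ c<n) ⟩
      (2 * ⌊ a ‼ c /2⌋ + mod2 (a ‼ c)) ∸ (2 * D c + mod2 (a ‼ c)) ≡⟨ cong₂ _∸_ (ℕₚ.+-comm _ (mod2 (a ‼ c))) (ℕₚ.+-comm _ (mod2 (a ‼ c))) ⟩
      (mod2 (a ‼ c) + 2 * ⌊ a ‼ c /2⌋) ∸ (mod2 (a ‼ c) + 2 * D c) ≡⟨ ℕₚ.[m+n]∸[m+o]≡n∸o (mod2 (a ‼ c)) _ _ ⟩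
      2 * ⌊ a ‼ c /2⌋ ∸ 2 * D c                             ≡⟨ ℕₚ.*-distribˡ-∸ 2 ⌊ a ‼ c /2⌋ (D c) ⟨
      2 * height c                                          ∎
      where open ≡-Reasoning
    height-antitone : ∀ c → height (suc c) ≤ height c
    height-antitone c with ℕₚ.<-≤-connex (suc c) n
    ... | inj₂ n≤1+c rewrite nth-outside 0 a (suc c) n≤1+c | ℕₚ.0∸n≡0 (D (suc c)) = z≤n
    ... | inj₁ 1+c<n = begin
      ⌊ a ‼ suc c /2⌋ ∸ D (suc c)                ≤⟨ ℕₚ.∸-monoˡ-≤ (D (suc c)) (ℕₚ.m+n≤o⇒m≤o∸n _ (steps 1+c<n)) ⟩
      ⌊ a ‼ c /2⌋ ∸ δ c ∸ D (suc c)              ≡⟨ ℕₚ.∸-+-assoc ⌊ a ‼ c /2⌋ (δ c) (D (suc c)) ⟩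
      ⌊ a ‼ c /2⌋ ∸ (δ c + D (suc c))            ≡⟨ cong (⌊ a ‼ c /2⌋ ∸_) (D-step c 1+c<n) ⟨
      height c                                   ∎
      where open ℕₚ.≤-Reasoning

  staircase⇒compatible : e ≤ᵛ a → Staircase 1 (a ∸ᵛ e) → Compatible a σ
  staircase⇒compatible e≤a s = (λ c<n → sym (proj₂ (halves c<n))) , steps
    where
    open Staircase s
    a‼ : ∀ {c} → c < n → a ‼ c ≡ 2 * (height c + D c) + ε c
    a‼ {c} c<n = begin
      a ‼ c                                ≡⟨ ℕₚ.m∸n+n≡m (e≤a c) ⟨
      a ‼ c ∸ e ‼ c + e ‼ c                ≡⟨ cong₂ _+_ (trans (sym (‼-∸ᵛ a e c)) (‼≡2*height c)) (sigmaExp-‼ c<n) ⟩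
      2 * height c + (2 * D c + ε c)       ≡⟨ ℕₚ.+-assoc (2 * height c) (2 * D c) (ε c) ⟨
      2 * height c + 2 * D c + ε c         ≡⟨ cong (_+ ε c) (ℕₚ.*-distribˡ-+ 2 (height c) (D c)) ⟨
      2 * (height c + D c) + ε c           ∎
      where open ≡-Reasoning
    halves : ∀ {c} → c < n → ⌊ a ‼ c /2⌋ ≡ height c + D c × mod2 (a ‼ c) ≡ ε c
    halves {c} c<n rewrite a‼ c<n = halve-mod2-unique (height c + D c) (ε c) (𝟙[<ᶻ]≤1 _ _)
    steps : ∀ {c} → suc c < n → StepFits (a ‼ c) (σ ‼ᶻ c) (a ‼ suc c) (σ ‼ᶻ suc c)
    steps {c} 1+c<n = begin
      ⌊ a ‼ suc c /2⌋ + δ c              ≡⟨ cong (_+ δ c) (proj₁ (halves 1+c<n)) ⟩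
      height (suc c) + D (suc c) + δ c    ≡⟨ ℕₚ.+-assoc (height (suc c)) (D (suc c)) (δ c) ⟩
      height (suc c) + (D (suc c) + δ c)  ≡⟨ cong (_+_ (height (suc c))) (trans (ℕₚ.+-comm (D (suc c)) (δ c)) (sym (D-step c 1+c<n))) ⟩
      height (suc c) + D c                ≤⟨ ℕₚ.+-monoˡ-≤ (D c) (height-antitone c) ⟩
      height c + D c                      ≡⟨ proj₁ (halves (ℕₚ.<-trans (ℕₚ.n<1+n c) 1+c<n)) ⟨
      ⌊ a ‼ c /2⌋                         ∎
      where open ℕₚ.≤-Reasoning

rhs≡#compatible : ∀ n (a : Exp n) → rhs n a ≡ + length (filter (compatible? a) (Bn n))
rhs≡#compatible n a = begin
  rhs n a
    ≡⟨ sumS-⊛ (map (mono ∘ sigmaExp) (Bn n)) G a ⟩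
  sumℤ (map (λ f → (f ⊛ G) a) (map (mono ∘ sigmaExp) (Bn n)))
    ≡⟨ cong sumℤ (Listₚ.map-∘ (Bn n)) ⟨
  sumℤ (map (λ σ → (mono (sigmaExp σ) ⊛ G) a) (Bn n))
    ≡⟨ cong sumℤ (Listₚ.map-cong (λ σ → term σ (compatible? a σ)) (Bn n)) ⟩
  sumℤ (map (λ σ → + indicator (does (compatible? a σ))) (Bn n))
    ≡⟨ sumℤ-indicator (compatible? a) (Bn n) ⟩
  + length (filter (compatible? a) (Bn n)) ∎
  where
  open ≡-Reasoning
  G : Series n
  G = geomProd n 1 n
  G-coeff : ∀ b → (Staircase 1 b → G b ≡ + 1) × (¬ Staircase 1 b → G b ≡ + 0)
  G-coeff = geomProd-coeff n n 1 ℕₚ.≤-refl refl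
  term : ∀ σ (c? : Dec (Compatible a σ)) → (mono (sigmaExp σ) ⊛ G) a ≡ + indicator (does c?)
  term σ (yes c) = let e≤a , s = CompatibleStaircase.compatible⇒staircase a σ c in
    trans (mono-⊛ (sigmaExp σ) a G e≤a) (proj₁ (G-coeff _) s)
  term σ (no ¬c) = mono-⊛-0 (sigmaExp σ) a G λ e≤a →
    proj₂ (G-coeff _) (¬c ∘ CompatibleStaircase.staircase⇒compatible a σ e≤a)

SignedPermList : ℕ → List ℤ → Set
SignedPermList m ws = All (λ s → 1 ≤ ∣ s ∣ × ∣ s ∣ ≤ m) ws × Unique (map ∣_∣ ws)

SignedPerm : ℕ → Vec ℤ l → Set
SignedPerm m w = SignedPermList m (toList w)

isSignedPerm⇒SignedPerm : ∀ m (w : Vec ℤ l) → T (isSignedPerm m w) → SignedPerm m w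
isSignedPerm⇒SignedPerm m w t
  with All.all? (λ s → (1 ℕ.≤? ∣ s ∣) ×-dec (∣ s ∣ ℕ.≤? m)) (toList w) | UniqueDec.unique? ℕ._≟_ (map ∣_∣ (toList w))
... | yes bounded | yes unique = bounded , unique

SignedPerm⇒isSignedPerm : ∀ m (w : Vec ℤ l) → SignedPerm m w → T (isSignedPerm m w)
SignedPerm⇒isSignedPerm m w (bounded , unique)
  with All.all? (λ s → (1 ℕ.≤? ∣ s ∣) ×-dec (∣ s ∣ ℕ.≤? m)) (toList w) | UniqueDec.unique? ℕ._≟_ (map ∣_∣ (toList w))
... | yes _ | yes _       = _
... | no ¬bounded | _     = ¬bounded bounded
... | yes _ | no ¬unique = ¬unique unique

∈-intRange : ∀ m s → ∣ s ∣ ≤ m → s ∈ intRange m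
∈-intRange m (+ j) j≤m = subst (_∈ intRange m) +j+m-m≡+j
  (∈ₚ.∈-map⁺ (λ i → + i ℤ.- + m) (∈ₚ.∈-applyUpTo⁺ (λ i → i) (s≤s j+m≤2m)))
  where
  j+m≤2m : j + m ≤ 2 * m
  j+m≤2m = ℕₚ.≤-trans (ℕₚ.+-monoˡ-≤ m j≤m) (ℕₚ.≤-reflexive (cong (_+_ m) (sym (ℕₚ.+-identityʳ m))))
  +j+m-m≡+j : + (j + m) ℤ.- + m ≡ + j
  +j+m-m≡+j = trans (ℤₚ.m-n≡m⊖n (j + m) m) (trans (ℤₚ.⊖-≥ (ℕₚ.m≤n+m m j)) (cong +_ (ℕₚ.m+n∸n≡m j m)))
∈-intRange m -[1+ j ] 1+j≤m = subst (_∈ intRange m) m-1-j-m≡-1-j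
  (∈ₚ.∈-map⁺ (λ i → + i ℤ.- + m) (∈ₚ.∈-applyUpTo⁺ (λ i → i) (s≤s (ℕₚ.≤-trans (ℕₚ.m∸n≤m m (suc j)) (ℕₚ.m≤m+n m _)))))
  where
  m-1-j-m≡-1-j : + (m ∸ suc j) ℤ.- + m ≡ -[1+ j ]
  m-1-j-m≡-1-j = trans (ℤₚ.m-n≡m⊖n (m ∸ suc j) m)
    (trans (ℤₚ.⊖-< (ℕₚ.∸-monoʳ-< {m} {suc j} {0} (s≤s z≤n) 1+j≤m)) (cong (λ i → ℤ.- (+ i)) (ℕₚ.m∸[m∸n]≡n 1+j≤m)))

intRange-Unique : ∀ m → Unique (intRange m)
intRange-Unique m = Uniqueₚ.map⁺ (λ {i} {j} eq → ℤₚ.+-injective (∙-cancelʳ (ℤ.- + m) (+ i) (+ j) eq)) (Uniqueₚ.upTo⁺ (suc (2 * m)))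
  where open AbelianGroupProperties ℤₚ.+-0-abelianGroup using (∙-cancelʳ)

∈-allVecs : ∀ m k (w : Vec ℤ k) → All (λ s → ∣ s ∣ ≤ m) (toList w) → w ∈ allVecs m k
∈-allVecs m zero    []      _            = here refl
∈-allVecs m (suc k) (s ∷ w) (s≤m ∷ w≤m) =
  ∈ₚ.∈-concat⁺′ (∈ₚ.∈-map⁺ (s ∷_) (∈-allVecs m k w w≤m)) (∈ₚ.∈-map⁺ (λ s → map (s ∷_) (allVecs m k)) (∈-intRange m s s≤m))

allVecs-Unique : ∀ m k → Unique (allVecs m k)
allVecs-Unique m zero    = [] ∷ []
allVecs-Unique m (suc k) =
  Unique-concatMap (λ s → map (s ∷_) (allVecs m k)) (intRange-Unique m)
    (λ _ → Uniqueₚ.map⁺ (cong Vec.tail) (allVecs-Unique m k)) heads-agree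
  where
  heads-agree : ∀ {s t w} → s ∈ intRange m → t ∈ intRange m →
                w ∈ map (s ∷_) (allVecs m k) → w ∈ map (t ∷_) (allVecs m k) → s ≡ t
  heads-agree _ _ w∈s w∈t with ∈ₚ.∈-map⁻ _ w∈s | ∈ₚ.∈-map⁻ _ w∈t
  ... | _ , _ , refl | _ , _ , eq = cong Vec.head eq

Bn-Unique : ∀ m → Unique (Bn m)
Bn-Unique m = Uniqueₚ.filter⁺ _ (allVecs-Unique m m)

∈-Bn⁻ : ∀ {m} {w : Vec ℤ m} → w ∈ Bn m → SignedPerm m w
∈-Bn⁻ {m} {w} w∈ = isSignedPerm⇒SignedPerm m w
  (proj₂ (∈ₚ.∈-filter⁻ (λ v → T? (isSignedPerm m v)) {xs = allVecs m m} w∈))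

∈-Bn⁺ : ∀ {m} {w : Vec ℤ m} → SignedPerm m w → w ∈ Bn m
∈-Bn⁺ {m} {w} sp@(bounded , _) = ∈ₚ.∈-filter⁺ (λ v → T? (isSignedPerm m v))
  (∈-allVecs m m w (All.map proj₂ bounded)) (SignedPerm⇒isSignedPerm m w sp)

toList-ins-↭ : ∀ {A : Set} p (t : A) (w : Vec A l) → toList (ins p t w) ↭ t ∷ toList w
toList-ins-↭ zero    t w       = ↭-refl
toList-ins-↭ (suc p) t []      = ↭-refl
toList-ins-↭ (suc p) t (s ∷ w) = ↭-trans (prep s (toList-ins-↭ p t w)) (swap s t ↭-refl)

SignedPermList-resp-↭ : ∀ {m ws ws′} → ws ↭ ws′ → SignedPermList m ws → SignedPermList m ws′
SignedPermList-resp-↭ ws↭ws′ (bounded , unique) =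
  ↭ₚ.All-resp-↭ ws↭ws′ bounded , ↭ₛₚ.Unique-resp-↭ (setoid ℕ) (↭⇒↭ₛ (↭ₚ.map⁺ ∣_∣ ws↭ws′)) unique

SignedPerm-ins : ∀ {m} p t (w : Vec ℤ m) → SignedPerm m w → ∣ t ∣ ≡ suc m → SignedPerm (suc m) (ins p t w)
SignedPerm-ins {m} p t w (bounded , unique) ∣t∣≡1+m = SignedPermList-resp-↭ (↭-sym (toList-ins-↭ p t w))
  ( (subst (1 ≤_) (sym ∣t∣≡1+m) (s≤s z≤n) , ℕₚ.≤-reflexive ∣t∣≡1+m) ∷ All.map (λ (1≤ , ≤m) → 1≤ , ℕₚ.m≤n⇒m≤1+n ≤m) bounded
  , Allₚ.map⁺ (All.map (λ (_ , ∣s∣≤m) ∣t∣≡∣s∣ → ℕₚ.<-irrefl (trans (sym ∣t∣≡∣s∣) ∣t∣≡1+m) (s≤s ∣s∣≤m)) bounded) ∷ unique )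

SignedPerm-rem : ∀ {m} p (σ : Vec ℤ (suc m)) → p ≤ m → SignedPerm (suc m) σ → ∣ σ ‼ᶻ p ∣ ≡ suc m → SignedPerm m (rem p σ)
SignedPerm-rem {m} p σ p≤m sp ∣σp∣≡1+m with SignedPermList-resp-↭ σ↭ sp
  where
  σ↭ : toList σ ↭ σ ‼ᶻ p ∷ toList (rem p σ)
  σ↭ = subst (λ v → toList v ↭ σ ‼ᶻ p ∷ toList (rem p σ)) (ins-rem (+ 0) σ p≤m) (toList-ins-↭ p (σ ‼ᶻ p) (rem p σ))
... | _ ∷ bounded , σp∉ ∷ unique =
  All.zipWith (λ ((1≤ , ≤1+m) , ∣σp∣≢∣s∣) → 1≤ , ℕₚ.≤-pred (ℕₚ.≤∧≢⇒< ≤1+m λ eq → ∣σp∣≢∣s∣ (trans ∣σp∣≡1+m (sym eq))))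
              (bounded , Allₚ.map⁻ σp∉) ,
  unique

-- Pigeonhole: otherwise the m + 1 distinct values ∣σ(i)∣ would all lie in [1, m].
top-position : ∀ {m} (σ : Vec ℤ (suc m)) → SignedPerm (suc m) σ → ∃ λ p → p < suc m × ∣ σ ‼ᶻ p ∣ ≡ suc m
top-position {m} σ (bounded , unique) with suc m ∈? map ∣_∣ (toList σ)
... | yes 1+m∈ = let s , s∈ , 1+m≡∣s∣ = ∈ₚ.∈-map⁻ ∣_∣ 1+m∈ ; p , p<1+m , σp≡s = ∈-nth (+ 0) σ s∈ in
  p , p<1+m , trans (cong ∣_∣ σp≡s) (sym 1+m≡∣s∣)
... | no 1+m∉ = ⊥-elim (ℕₚ.<-irrefl refl (ℕₚ.≤-trans too-many (ℕₚ.≤-reflexive (Listₚ.length-applyUpTo suc m))))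
  where
  ⊆range : ∀ {j} → j ∈ map ∣_∣ (toList σ) → j ∈ applyUpTo suc m
  ⊆range j∈ with ∈ₚ.∈-map⁻ ∣_∣ j∈
  ... | s , s∈ , refl = let 1≤∣s∣ , ∣s∣≤1+m = All.lookup bounded s∈ in
    ∈-applyUpTo-suc 1≤∣s∣ (ℕₚ.≤-pred (ℕₚ.≤∧≢⇒< ∣s∣≤1+m λ ∣s∣≡1+m → 1+m∉ (subst (_∈ _) ∣s∣≡1+m j∈)))
    where
    ∈-applyUpTo-suc : ∀ {j} → 1 ≤ j → j ≤ m → j ∈ applyUpTo suc m
    ∈-applyUpTo-suc {suc i} _ i<m = ∈ₚ.∈-applyUpTo⁺ suc i<m
  too-many : suc m ≤ length (applyUpTo suc m)
  too-many = subst (_≤ _) (trans (Listₚ.length-map ∣_∣ (toList σ)) (length-toList σ))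
                   (length-≤-Unique-⊆ unique ⊆range)

-- Inserting and deleting the letter ±n

mod2-cases : ∀ x → mod2 x ≡ 0 ⊎ mod2 x ≡ 1
mod2-cases zero          = inj₁ refl
mod2-cases (suc zero)    = inj₂ refl
mod2-cases (suc (suc x)) = mod2-cases x

⌊/2⌋-odd-< : ∀ {x y} → mod2 x ≡ 1 → x < y → suc ⌊ x /2⌋ ≤ ⌊ y /2⌋
⌊/2⌋-odd-< {suc zero}    {suc zero}    _  (s≤s ())
⌊/2⌋-odd-< {suc zero}    {suc (suc y)} _  _                 = s≤s z≤n
⌊/2⌋-odd-< {suc (suc x)} {suc (suc y)} odd (s≤s (s≤s x<y)) = s≤s (⌊/2⌋-odd-< odd x<y)

⌊/2⌋-even-< : ∀ {x y} → mod2 x ≡ 0 → y < x → suc ⌊ y /2⌋ ≤ ⌊ x /2⌋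
⌊/2⌋-even-< {suc (suc x)} {zero}        _    _                 = s≤s z≤n
⌊/2⌋-even-< {suc (suc x)} {suc zero}    _    _                 = s≤s z≤n
⌊/2⌋-even-< {suc (suc x)} {suc (suc y)} even (s≤s (s≤s y<x)) = s≤s (⌊/2⌋-even-< even y<x)

top : ℕ → ℕ → ℤ
top m x = signed (mod2 x)
  where
  signed : ℕ → ℤ
  signed zero    = + suc m
  signed (suc _) = -[1+ m ]

∣top∣ : ∀ m x → ∣ top m x ∣ ≡ suc m
∣top∣ m x with mod2 x
... | zero  = refl
... | suc _ = refl

top-SignFits : ∀ m x → SignFits x (top m x)
top-SignFits m x with mod2 x | mod2≤1 x
... | zero          | _        = refl
... | suc zero      | _        = refl
... | suc (suc _)   | s≤s ()

SignFits-top : ∀ {m x t} → SignFits x t → ∣ t ∣ ≡ suc m → t ≡ top m x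
SignFits-top {m} {x} {+ _}      fits refl with mod2 x
... | zero = refl
SignFits-top {m} {x} { -[1+ _ ]} fits refl with mod2 x
... | suc zero = refl

top-even : ∀ {m} x {s} → mod2 x ≡ 0 → ∣ s ∣ ≤ m → s ℤ.< top m x
top-even x {+ _}      even s≤m rewrite even = ℤ.+<+ (s≤s s≤m)
top-even x { -[1+ _ ]} even s≤m rewrite even = ℤ.-<+

top-odd : ∀ {m} x {s} → mod2 x ≡ 1 → ∣ s ∣ ≤ m → top m x ℤ.< s
top-odd x {+ _}      odd s≤m rewrite odd = ℤ.-<+
top-odd x { -[1+ _ ]} odd s≤m rewrite odd = ℤ.-<- s≤m

𝟙-true : ∀ {s t} → s ℤ.< t → 𝟙[ s <ᶻ t ] ≡ 1
𝟙-true {s} {t} s<t = cong indicator (⌊⌋-true (s ℤ.<? t) s<t)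

𝟙-false : ∀ {s t} → ¬ s ℤ.< t → 𝟙[ s <ᶻ t ] ≡ 0
𝟙-false {s} {t} s≮t = cong indicator (⌊⌋-false (s ℤ.<? t) s≮t)

StepFits-0 : ∀ {x s y t} → 𝟙[ t <ᶻ s ] ≡ 0 → ⌊ y /2⌋ ≤ ⌊ x /2⌋ → StepFits x s y t
StepFits-0 {x} {y = y} 𝟙≡0 le = subst (_≤ ⌊ x /2⌋) (sym (trans (cong (_+_ ⌊ y /2⌋) 𝟙≡0) (ℕₚ.+-identityʳ ⌊ y /2⌋))) le

StepFits-1 : ∀ {x s y t} → 𝟙[ t <ᶻ s ] ≡ 1 → suc ⌊ y /2⌋ ≤ ⌊ x /2⌋ → StepFits x s y t
StepFits-1 {x} {y = y} 𝟙≡1 le = subst (_≤ ⌊ x /2⌋) (sym (trans (cong (_+_ ⌊ y /2⌋) 𝟙≡1) (ℕₚ.+-comm ⌊ y /2⌋ 1))) le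

StepFits-1⁻ : ∀ {x s y t} → 𝟙[ t <ᶻ s ] ≡ 1 → StepFits x s y t → suc ⌊ y /2⌋ ≤ ⌊ x /2⌋
StepFits-1⁻ {x} {y = y} 𝟙≡1 fits = subst (_≤ ⌊ x /2⌋) (trans (cong (_+_ ⌊ y /2⌋) 𝟙≡1) (ℕₚ.+-comm ⌊ y /2⌋ 1)) fits

StepFits-into-top : ∀ {m x y s} → ∣ s ∣ ≤ m → x ≤ y → (mod2 x ≡ 1 → y ≢ x) → StepFits y s x (top m x)
StepFits-into-top {x = x} s≤m x≤y odd⇒≢ with mod2-cases x
... | inj₁ even = StepFits-0 (𝟙-false (ℤₚ.<-asym (top-even x even s≤m))) (ℕₚ.⌊n/2⌋-mono x≤y)
... | inj₂ odd  = StepFits-1 (𝟙-true (top-odd x odd s≤m)) (⌊/2⌋-odd-< odd (ℕₚ.≤∧≢⇒< x≤y (odd⇒≢ odd ∘ sym)))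

StepFits-from-top : ∀ {m x y t} → ∣ t ∣ ≤ m → y ≤ x → (mod2 x ≡ 0 → y ≢ x) → StepFits x (top m x) y t
StepFits-from-top {x = x} t≤m y≤x even⇒≢ with mod2-cases x
... | inj₁ even = StepFits-1 (𝟙-true (top-even x even t≤m)) (⌊/2⌋-even-< even (ℕₚ.≤∧≢⇒< y≤x (even⇒≢ even)))
... | inj₂ odd  = StepFits-0 (𝟙-false (ℤₚ.<-asym (top-odd x odd t≤m))) (ℕₚ.⌊n/2⌋-mono y≤x)

StepFits-into-top⁻ : ∀ {m x y s} → ∣ s ∣ ≤ m → StepFits y s x (top m x) → mod2 x ≡ 1 → y ≢ x
StepFits-into-top⁻ {x = x} s≤m fits odd refl = ℕₚ.<-irrefl refl (StepFits-1⁻ (𝟙-true (top-odd x odd s≤m)) fits)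

StepFits-from-top⁻ : ∀ {m x y t} → ∣ t ∣ ≤ m → StepFits x (top m x) y t → mod2 x ≡ 0 → y ≢ x
StepFits-from-top⁻ {x = x} t≤m fits even refl = ℕₚ.<-irrefl refl (StepFits-1⁻ (𝟙-true (top-even x even t≤m)) fits)

StepFits-trans : ∀ {x s} y t {z u} → StepFits x s y t → StepFits y t z u → StepFits x s z u
StepFits-trans {x} {s} y t {z} {u} xy yz = begin
  ⌊ z /2⌋ + 𝟙[ u <ᶻ s ]                       ≤⟨ ℕₚ.+-monoʳ-≤ ⌊ z /2⌋ (descents-subadditive (t ℤ.<? s) (u ℤ.<? t) (u ℤ.<? s)) ⟩
  ⌊ z /2⌋ + (𝟙[ t <ᶻ s ] + 𝟙[ u <ᶻ t ])       ≡⟨ cong (_+_ ⌊ z /2⌋) (ℕₚ.+-comm 𝟙[ t <ᶻ s ] _) ⟩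
  ⌊ z /2⌋ + (𝟙[ u <ᶻ t ] + 𝟙[ t <ᶻ s ])       ≡⟨ ℕₚ.+-assoc ⌊ z /2⌋ _ _ ⟨
  ⌊ z /2⌋ + 𝟙[ u <ᶻ t ] + 𝟙[ t <ᶻ s ]         ≤⟨ ℕₚ.+-monoˡ-≤ 𝟙[ t <ᶻ s ] yz ⟩
  ⌊ y /2⌋ + 𝟙[ t <ᶻ s ]                       ≤⟨ xy ⟩
  ⌊ x /2⌋                                     ∎
  where
  open ℕₚ.≤-Reasoning
  descents-subadditive : (t<s : Dec (t ℤ.< s)) (u<t : Dec (u ℤ.< t)) (u<s : Dec (u ℤ.< s)) →
                         indicator ⌊ u<s ⌋ ≤ indicator ⌊ t<s ⌋ + indicator ⌊ u<t ⌋
  descents-subadditive _         _         (no _)    = z≤n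
  descents-subadditive (yes _)   _         (yes _)   = s≤s z≤n
  descents-subadditive (no _)    (yes _)   (yes _)   = s≤s z≤n
  descents-subadditive (no t≮s) (no u≮t) (yes u<s) = ⊥-elim (u≮t (ℤₚ.<-≤-trans u<s (ℤₚ.≮⇒≥ t≮s)))

pred[n]<n : ∀ {p} → 0 < p → ℕ.pred p < p
pred[n]<n {suc p} _ = ℕₚ.≤-refl

Decreasing : Exp n → Set
Decreasing {n} a = ∀ {c} → suc c < n → a ‼ suc c ≤ a ‼ c

-- For weakly decreasing a: the positions at which a compatible signed permutation can have its letter ±n.
Admissible : Exp n → ℕ → Set
Admissible {n} a p = (mod2 (a ‼ p) ≡ 0 → suc p < n → a ‼ suc p ≢ a ‼ p)
                   × (mod2 (a ‼ p) ≡ 1 → 0 < p → a ‼ ℕ.pred p ≢ a ‼ p)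

admissible? : ∀ (a : Exp n) p → Dec (Admissible a p)
admissible? {n} a p =
  (mod2 (a ‼ p) ℕ.≟ 0 →-dec (suc p ℕ.<? n →-dec ¬? (a ‼ suc p ℕ.≟ a ‼ p))) ×-dec
  (mod2 (a ‼ p) ℕ.≟ 1 →-dec (0 ℕ.<? p →-dec ¬? (a ‼ ℕ.pred p ℕ.≟ a ‼ p)))

module _ {m : ℕ} (x : ℕ) (a′ : Exp m) (w : Vec ℤ m) (w-bounded : ∀ {c} → c < m → ∣ w ‼ᶻ c ∣ ≤ m) where

  private
    t : ℤ
    t = top m x
    a : ℕ → Exp (suc m)
    a p = ins p x a′

  fits-left : ∀ p → p ≤ m → Decreasing (a p) → (mod2 x ≡ 1 → 0 < p → a p ‼ ℕ.pred p ≢ a p ‼ p) →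
              0 < p → StepFits (a′ ‼ ℕ.pred p) (w ‼ᶻ ℕ.pred p) x t
  fits-left (suc q) p≤m dec odd⇒≢ _ = StepFits-into-top (w-bounded p≤m) x≤a′q λ odd a′q≡x →
    odd⇒≢ odd (s≤s z≤n) (trans a‼q≡a′q (trans a′q≡x (sym a‼p≡x)))
    where
    a‼p≡x : a (suc q) ‼ suc q ≡ x
    a‼p≡x = nth-ins-≡ 0 x a′ p≤m
    a‼q≡a′q : a (suc q) ‼ q ≡ a′ ‼ q
    a‼q≡a′q = nth-ins-< 0 x a′ p≤m ℕₚ.≤-refl
    x≤a′q : x ≤ a′ ‼ q
    x≤a′q = subst₂ _≤_ a‼p≡x a‼q≡a′q (dec (s≤s p≤m))

  fits-right : ∀ p → p ≤ m → Decreasing (a p) → (mod2 x ≡ 0 → suc p < suc m → a p ‼ suc p ≢ a p ‼ p) →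
               p < m → StepFits x t (a′ ‼ p) (w ‼ᶻ p)
  fits-right p p≤m dec even⇒≢ p<m = StepFits-from-top (w-bounded p<m) a′p≤x λ even a′p≡x →
    even⇒≢ even (s≤s p<m) (trans a‼1+p≡a′p (trans a′p≡x (sym a‼p≡x)))
    where
    a‼p≡x : a p ‼ p ≡ x
    a‼p≡x = nth-ins-≡ 0 x a′ p≤m
    a‼1+p≡a′p : a p ‼ suc p ≡ a′ ‼ p
    a‼1+p≡a′p = nth-ins-> 0 x a′ ℕₚ.≤-refl
    a′p≤x : a′ ‼ p ≤ x
    a′p≤x = subst₂ _≤_ a‼1+p≡a′p a‼p≡x (dec (s≤s p<m))

  insert-compatible : ∀ p → p ≤ m → Decreasing (a p) → Admissible (a p) p → Compatible a′ w → Compatible (a p) (ins p t w)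
  insert-compatible p p≤m dec (even⇒≢ , odd⇒≢) (signs , steps) =
    Everywhere-ins 0 (+ 0) {P = SignFits} p x t a′ w (top-SignFits m x) signs ,
    Adjacent-ins 0 (+ 0) {R = StepFits} p x t a′ w p≤m steps
      (fits-left p p≤m dec (odd⇒≢ ∘ subst (λ y → mod2 y ≡ 1) (sym a‼p≡x)))
      (fits-right p p≤m dec (even⇒≢ ∘ subst (λ y → mod2 y ≡ 0) (sym a‼p≡x)))
    where
    a‼p≡x : a p ‼ p ≡ x
    a‼p≡x = nth-ins-≡ 0 x a′ p≤m

  remove-compatible : ∀ p → p ≤ m → Compatible (a p) (ins p t w) → Admissible (a p) p × Compatible a′ w
  remove-compatible p p≤m (signs , steps) =
    (even⇒≢ , odd⇒≢) ,
    proj₂ (Everywhere-rem 0 (+ 0) {P = SignFits} p x t a′ w p≤m signs) ,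
    Adjacent-rem 0 (+ 0) {R = StepFits} p x t a′ w p≤m (λ {y} {s} {z} {u} → StepFits-trans {y} {s} x t {z} {u}) steps
    where
    a‼p≡x : a p ‼ p ≡ x
    a‼p≡x = nth-ins-≡ 0 x a′ p≤m
    even⇒≢ : mod2 (a p ‼ p) ≡ 0 → suc p < suc m → a p ‼ suc p ≢ a p ‼ p
    even⇒≢ even (s≤s p<m) eq =
      StepFits-from-top⁻ (w-bounded p<m) (Adjacent-ins-right 0 (+ 0) {R = StepFits} p x t a′ w p≤m steps p<m)
        (subst (λ y → mod2 y ≡ 0) a‼p≡x even) (trans (sym (nth-ins-> 0 x a′ ℕₚ.≤-refl)) (trans eq a‼p≡x))
    odd⇒≢ : mod2 (a p ‼ p) ≡ 1 → 0 < p → a p ‼ ℕ.pred p ≢ a p ‼ p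
    odd⇒≢ odd 0<p eq =
      StepFits-into-top⁻ (w-bounded (ℕₚ.<-≤-trans (pred[n]<n 0<p) p≤m)) (Adjacent-ins-left 0 (+ 0) {R = StepFits} p x t a′ w p≤m steps 0<p)
        (subst (λ y → mod2 y ≡ 1) a‼p≡x odd) (trans (sym (nth-ins-< 0 x a′ p≤m (pred[n]<n 0<p))) (trans eq a‼p≡x))

-- Counting compatible signed permutations

SignedPerm-bounded : ∀ {w : Vec ℤ l} → SignedPerm m w → ∀ {c} → c < l → ∣ w ‼ᶻ c ∣ ≤ m
SignedPerm-bounded {w = w} (bounded , _) c<l = proj₂ (All.lookup bounded (nth-∈ (+ 0) w c<l))

#compatible : Exp n → ℕ
#compatible {n} a = length (filter (compatible? a) (Bn n))

admissiblePositions : Exp n → List ℕ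
admissiblePositions {n} a = filter (admissible? a) (upTo n)

∈-admissiblePositions⁻ : ∀ (a : Exp n) {p} → p ∈ admissiblePositions a → p < n × Admissible a p
∈-admissiblePositions⁻ {n} a p∈ with ∈ₚ.∈-filter⁻ (admissible? a) {xs = upTo n} p∈
... | p∈upTo , adm with ∈ₚ.∈-applyUpTo⁻ (λ k → k) p∈upTo
... | _ , p<n , refl = p<n , adm

module Extensions {m : ℕ} (a : Exp (suc m)) where

  extend : ℕ → Vec ℤ m → Vec ℤ (suc m)
  extend p = ins p (top m (a ‼ p))
  extensions : ℕ → List (Vec ℤ (suc m))
  extensions p = map (extend p) (filter (compatible? (rem p a)) (Bn m))
  a≡ : ∀ {p} → p ≤ m → ins p (a ‼ p) (rem p a) ≡ a
  a≡ = ins-rem 0 a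

  ∈-extensions⁻ : ∀ {σ} → σ ∈ concatMap extensions (admissiblePositions a) →
                  ∃ λ p → ∃ λ w → σ ≡ extend p w × p ≤ m × Admissible a p × w ∈ Bn m × Compatible (rem p a) w
  ∈-extensions⁻ σ∈ with ∈ₚ.∈-concat⁻′ (map extensions (admissiblePositions a)) σ∈
  ... | _ , σ∈ext , ext∈ with ∈ₚ.∈-map⁻ extensions ext∈
  ... | p , p∈ , refl with ∈ₚ.∈-map⁻ (extend p) σ∈ext
  ... | w , w∈ , refl = let p<1+m , adm = ∈-admissiblePositions⁻ a p∈ ; w∈Bn , compat = ∈ₚ.∈-filter⁻ (compatible? (rem p a)) w∈ in
    p , w , refl , ℕₚ.≤-pred p<1+m , adm , w∈Bn , compat

  extend-SignedPerm : ∀ {p w} → w ∈ Bn m → SignedPerm (suc m) (extend p w)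
  extend-SignedPerm {p} {w} w∈ = SignedPerm-ins p _ w (∈-Bn⁻ w∈) (∣top∣ m (a ‼ p))

  extensions⊆compatible : Decreasing a → ∀ {σ} → σ ∈ concatMap extensions (admissiblePositions a) →
                          σ ∈ filter (compatible? a) (Bn (suc m))
  extensions⊆compatible dec σ∈ with ∈-extensions⁻ σ∈
  ... | p , w , refl , p≤m , adm , w∈ , compat = ∈ₚ.∈-filter⁺ (compatible? a) (∈-Bn⁺ (extend-SignedPerm w∈))
    (subst (λ a → Compatible a (extend p w)) (a≡ p≤m)
      (insert-compatible (a ‼ p) (rem p a) w (SignedPerm-bounded (∈-Bn⁻ w∈)) p p≤m
        (subst Decreasing (sym (a≡ p≤m)) dec) (subst (λ a → Admissible a p) (sym (a≡ p≤m)) adm) compat))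

  compatible⊆extensions : ∀ {σ} → σ ∈ filter (compatible? a) (Bn (suc m)) → σ ∈ concatMap extensions (admissiblePositions a)
  compatible⊆extensions {σ} σ∈ with ∈ₚ.∈-filter⁻ (compatible? a) {xs = Bn (suc m)} σ∈
  ... | σ∈Bn , compat with top-position σ (∈-Bn⁻ σ∈Bn)
  ... | p , s≤s p≤m , ∣σp∣≡1+m = subst (_∈ _) σ≡ $
    ∈ₚ.∈-concat⁺′ (∈ₚ.∈-map⁺ (extend p) (∈ₚ.∈-filter⁺ (compatible? (rem p a)) (∈-Bn⁺ w-SignedPerm) (proj₂ removed)))
                  (∈ₚ.∈-map⁺ extensions (∈ₚ.∈-filter⁺ (admissible? a) (∈ₚ.∈-applyUpTo⁺ (λ k → k) (s≤s p≤m)) adm))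
    where
    w : Vec ℤ m
    w = rem p σ
    w-SignedPerm : SignedPerm m w
    w-SignedPerm = SignedPerm-rem p σ p≤m (∈-Bn⁻ σ∈Bn) ∣σp∣≡1+m
    σp≡top : σ ‼ᶻ p ≡ top m (a ‼ p)
    σp≡top = SignFits-top {m} {a ‼ p} (proj₁ compat (s≤s p≤m)) ∣σp∣≡1+m
    σ≡ : extend p w ≡ σ
    σ≡ = trans (cong (λ t → ins p t w) (sym σp≡top)) (ins-rem (+ 0) σ p≤m)
    removed : Admissible (ins p (a ‼ p) (rem p a)) p × Compatible (rem p a) w
    removed = remove-compatible (a ‼ p) (rem p a) w (SignedPerm-bounded w-SignedPerm) p p≤m
                (subst₂ Compatible (sym (a≡ p≤m)) (sym σ≡) compat)
    adm : Admissible a p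
    adm = subst (λ a → Admissible a p) (a≡ p≤m) (proj₁ removed)

  extensions-Unique : Unique (concatMap extensions (admissiblePositions a))
  extensions-Unique = Unique-concatMap extensions (Uniqueₚ.filter⁺ (admissible? a) (Uniqueₚ.upTo⁺ (suc m)))
    (λ p∈ → Uniqueₚ.map⁺ (extend-injective (ℕₚ.≤-pred (proj₁ (∈-admissiblePositions⁻ a p∈))))
                         (Uniqueₚ.filter⁺ _ (Bn-Unique m)))
    same-position
    where
    extend-injective : ∀ {p} → p ≤ m → ∀ {w w′} → extend p w ≡ extend p w′ → w ≡ w′
    extend-injective {p} p≤m {w} {w′} eq = trans (sym (rem-ins _ w p≤m)) (trans (cong (rem p) eq) (rem-ins _ w′ p≤m))
    same-position : ∀ {p q σ} → p ∈ admissiblePositions a → q ∈ admissiblePositions a →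
                    σ ∈ extensions p → σ ∈ extensions q → p ≡ q
    same-position {p} {q} p∈ q∈ σ∈p σ∈q with ∈ₚ.∈-map⁻ (extend p) σ∈p | ∈ₚ.∈-map⁻ (extend q) σ∈q
    ... | w , w∈ , refl | w′ , _ , σ≡ =
      Unique-nth-injective (+ 0) ∣_∣ (extend p w) (proj₂ (extend-SignedPerm (proj₁ (∈ₚ.∈-filter⁻ _ {xs = Bn m} w∈))))
        (proj₁ (∈-admissiblePositions⁻ a p∈)) (proj₁ (∈-admissiblePositions⁻ a q∈))
        (trans (∣top-at∣ p p≤m w) (sym (trans (cong (λ σ → ∣ σ ‼ᶻ q ∣) σ≡) (∣top-at∣ q q≤m w′))))
      where
      p≤m : p ≤ m
      p≤m = ℕₚ.≤-pred (proj₁ (∈-admissiblePositions⁻ a p∈))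
      q≤m : q ≤ m
      q≤m = ℕₚ.≤-pred (proj₁ (∈-admissiblePositions⁻ a q∈))
      ∣top-at∣ : ∀ r → r ≤ m → ∀ v → ∣ extend r v ‼ᶻ r ∣ ≡ suc m
      ∣top-at∣ r r≤m v = trans (cong ∣_∣ (nth-ins-≡ (+ 0) _ v r≤m)) (∣top∣ m (a ‼ r))

#compatible-step : ∀ (a : Exp (suc m)) → Decreasing a →
                   #compatible a ≡ sum (map (λ p → #compatible (rem p a)) (admissiblePositions a))
#compatible-step {m} a dec = begin
  length (filter (compatible? a) (Bn (suc m)))
    ≡⟨ length-≡-Unique-⊆⊇ (Uniqueₚ.filter⁺ (compatible? a) (Bn-Unique (suc m))) extensions-Unique
                          compatible⊆extensions (extensions⊆compatible dec) ⟩
  length (concatMap extensions (admissiblePositions a))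
    ≡⟨ length-concatMap extensions (admissiblePositions a) ⟩
  sum (map (length ∘ extensions) (admissiblePositions a))
    ≡⟨ cong sum (Listₚ.map-cong (λ p → Listₚ.length-map (extend p) (filter (compatible? (rem p a)) (Bn m))) (admissiblePositions a)) ⟩
  sum (map (λ p → #compatible (rem p a)) (admissiblePositions a)) ∎
  where
  open ≡-Reasoning
  open Extensions a

Decreasing-everywhere : ∀ {a : Exp n} → Decreasing a → ∀ c → a ‼ suc c ≤ a ‼ c
Decreasing-everywhere {n} {a} dec c with ℕₚ.<-≤-connex (suc c) n
... | inj₁ 1+c<n = dec 1+c<n
... | inj₂ n≤1+c = ℕₚ.≤-trans (ℕₚ.≤-reflexive (nth-outside 0 a (suc c) n≤1+c)) z≤n

Decreasing-antitone : ∀ {a : Exp n} → Decreasing a → ∀ {c d} → c ≤ d → a ‼ d ≤ a ‼ c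
Decreasing-antitone {a = a} dec = antitone (a ‼_) (Decreasing-everywhere {a = a} dec)

Decreasing-rem : ∀ p (a : Exp (suc n)) → Decreasing a → Decreasing (rem p a)
Decreasing-rem zero          (x ∷ a)         dec = dec ∘ s≤s
Decreasing-rem (suc zero)    (x ∷ y ∷ z ∷ a) dec {zero} _ = ℕₚ.≤-trans (dec (s≤s (s≤s (s≤s z≤n)))) (dec (s≤s (s≤s z≤n)))
Decreasing-rem (suc (suc p)) (x ∷ y ∷ z ∷ a) dec {zero} _ = dec (s≤s (s≤s z≤n))
Decreasing-rem (suc p)       (x ∷ y ∷ a)     dec {suc c} (s≤s 1+c<n)
  rewrite rem-suc p x (y ∷ a) = Decreasing-rem p (y ∷ a) (dec ∘ s≤s) 1+c<n

halves≤∧<⇒even-odd : ∀ {x y} → ⌊ y /2⌋ ≤ ⌊ x /2⌋ → x < y → mod2 x ≡ 0 × mod2 y ≡ 1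
halves≤∧<⇒even-odd {x} {y} hy≤hx x<y with mod2-cases x | mod2-cases y
... | inj₁ x-even | inj₂ y-odd = x-even , y-odd
... | inj₂ x-odd  | _          = ⊥-elim (ℕₚ.<-irrefl refl (ℕₚ.≤-trans (⌊/2⌋-odd-< x-odd x<y) hy≤hx))
... | inj₁ x-even | inj₁ y-even = ⊥-elim (ℕₚ.<-irrefl refl (ℕₚ.≤-trans x<y (begin
  y                   ≡⟨ halve-mod2 y ⟩
  2 * ⌊ y /2⌋ + mod2 y ≡⟨ cong (_+_ (2 * ⌊ y /2⌋)) y-even ⟩
  2 * ⌊ y /2⌋ + 0     ≤⟨ ℕₚ.+-monoˡ-≤ 0 (ℕₚ.*-monoʳ-≤ 2 hy≤hx) ⟩
  2 * ⌊ x /2⌋ + 0     ≡⟨ cong (_+_ (2 * ⌊ x /2⌋)) x-even ⟨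
  2 * ⌊ x /2⌋ + mod2 x ≡⟨ halve-mod2 x ⟨
  x                   ∎)))
  where open ℕₚ.≤-Reasoning

-- If a_c < a_{c+1}, equal halves force a_c even and a_{c+1} odd, hence σ(c) > 0 > σ(c+1): a descent.
Compatible⇒Decreasing : ∀ {a : Exp n} {σ} → Compatible a σ → Decreasing a
Compatible⇒Decreasing {n} {a} {σ} (signs , steps) {c} 1+c<n with a ‼ suc c ℕ.≤? a ‼ c
... | yes le = le
... | no a‼c≱ = ⊥-elim (ℕₚ.<-irrefl refl (ℕₚ.≤-trans (StepFits-1⁻ (𝟙-true descent) (steps 1+c<n)) (ℕₚ.⌊n/2⌋-mono (ℕₚ.<⇒≤ a‼c<))))
  where
  a‼c< : a ‼ c < a ‼ suc c
  a‼c< = ℕₚ.≰⇒> a‼c≱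
  parities : mod2 (a ‼ c) ≡ 0 × mod2 (a ‼ suc c) ≡ 1
  parities = halves≤∧<⇒even-odd (ℕₚ.≤-trans (ℕₚ.m≤m+n _ _) (steps 1+c<n)) a‼c<
  σc≮0 : ¬ σ ‼ᶻ c ℤ.< + 0
  σc≮0 σc<0 = ℕₚ.1+n≢0 (trans (sym (𝟙-true σc<0)) (trans (signs (ℕₚ.<-trans (ℕₚ.n<1+n c) 1+c<n)) (proj₁ parities)))
  σ1+c<0 : σ ‼ᶻ suc c ℤ.< + 0
  σ1+c<0 with σ ‼ᶻ suc c ℤ.<? + 0
  ... | yes lt = lt
  ... | no ≮0 = ⊥-elim (ℕₚ.0≢1+n (trans (sym (𝟙-false ≮0)) (trans (signs 1+c<n) (proj₂ parities))))
  descent : σ ‼ᶻ suc c ℤ.< σ ‼ᶻ c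
  descent = ℤₚ.<-≤-trans σ1+c<0 (ℤₚ.≮⇒≥ σc≮0)

toList≡map-‼ : ∀ (v : Exp n) → toList v ≡ map (v ‼_) (upTo n)
toList≡map-‼ []      = refl
toList≡map-‼ {suc n} (x ∷ v) = cong (x ∷_) (begin
  toList v                                 ≡⟨ toList≡map-‼ v ⟩
  map (v ‼_) (upTo n)                      ≡⟨ Listₚ.map-∘ (upTo n) ⟩
  map ((x ∷ v) ‼_) (map suc (upTo n))      ≡⟨ cong (map ((x ∷ v) ‼_)) (Listₚ.map-upTo suc n) ⟩
  map ((x ∷ v) ‼_) (applyUpTo suc n)       ∎)
  where open ≡-Reasoning

mult≡sum : ∀ j (v : Exp n) → mult j v ≡ sum (map (λ q → indicator (does (v ‼ q ℕ.≟ j))) (upTo n))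
mult≡sum {n} j v = begin
  length (filter (ℕ._≟ j) (toList v))                        ≡⟨ length-filter≡sum (ℕ._≟ j) (toList v) ⟩
  sum (map (λ x → indicator (does (x ℕ.≟ j))) (toList v))    ≡⟨ cong (λ xs → sum (map (λ x → indicator (does (x ℕ.≟ j))) xs)) (toList≡map-‼ v) ⟩
  sum (map (λ x → indicator (does (x ℕ.≟ j))) (map (v ‼_) (upTo n))) ≡⟨ cong sum (Listₚ.map-∘ (upTo n)) ⟨
  sum (map (λ q → indicator (does (v ‼ q ℕ.≟ j))) (upTo n))  ∎
  where open ≡-Reasoning

module _ {n : ℕ} (a : Exp n) (dec : Decreasing a) where

  private
    end-of-block : ∀ k p → suc p + k ≡ n → ∃ λ r → r < n × a ‼ r ≡ a ‼ p × (suc r < n → a ‼ suc r ≢ a ‼ p)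
    end-of-block zero    p 1+p+0≡n = p , p<n , refl , λ 1+p<n → ⊥-elim (ℕₚ.<⇒≱ 1+p<n n≤1+p)
      where
      p<n : p < n
      p<n = subst (p <_) 1+p+0≡n (ℕₚ.m≤m+n (suc p) 0)
      n≤1+p : n ≤ suc p
      n≤1+p = subst (_≤ suc p) 1+p+0≡n (ℕₚ.≤-reflexive (ℕₚ.+-identityʳ (suc p)))
    end-of-block (suc k) p 1+p+1+k≡n with a ‼ suc p ℕ.≟ a ‼ p
    ... | no a‼1+p≢ = p , subst (p <_) 1+p+1+k≡n (ℕₚ.m≤m+n (suc p) (suc k)) , refl , λ _ → a‼1+p≢
    ... | yes a‼1+p≡ =
      let r , r<n , a‼r≡ , end = end-of-block k (suc p) (trans (sym (ℕₚ.+-suc (suc p) k)) 1+p+1+k≡n) in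
      r , r<n , trans a‼r≡ a‼1+p≡ , λ 1+r<n eq → end 1+r<n (trans eq (sym a‼1+p≡))

    start-of-block : ∀ p → p < n → ∃ λ r → r < n × a ‼ r ≡ a ‼ p × (0 < r → a ‼ ℕ.pred r ≢ a ‼ p)
    start-of-block zero    0<n = zero , 0<n , refl , λ ()
    start-of-block (suc q) q<n with a ‼ q ℕ.≟ a ‼ suc q
    ... | no a‼q≢ = suc q , q<n , refl , λ _ → a‼q≢
    ... | yes a‼q≡ =
      let r , r<n , a‼r≡ , start = start-of-block q (ℕₚ.<-trans (ℕₚ.n<1+n q) q<n) in
      r , r<n , trans a‼r≡ a‼q≡ , λ 0<r eq → start 0<r (trans eq (sym a‼q≡))

  admissible-exists : ∀ {q} → q < n → ∃ λ p → p < n × Admissible a p × a ‼ p ≡ a ‼ q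
  admissible-exists {q} q<n with mod2-cases (a ‼ q)
  ... | inj₁ even = let r , r<n , a‼r≡ , end = end-of-block (n ∸ suc q) q (ℕₚ.m+[n∸m]≡n q<n) in
    r , r<n , ((λ _ 1+r<n eq → end 1+r<n (trans eq a‼r≡)) ,
               (λ odd → ⊥-elim (ℕₚ.0≢1+n (trans (sym even) (trans (cong mod2 (sym a‼r≡)) odd))))) , a‼r≡
  ... | inj₂ odd = let r , r<n , a‼r≡ , start = start-of-block q q<n in
    r , r<n , ((λ even → ⊥-elim (ℕₚ.0≢1+n (trans (sym even) (trans (cong mod2 a‼r≡) odd)))) ,
               (λ _ 0<r eq → start 0<r (trans eq a‼r≡))) , a‼r≡

  private
    admissible-ordered : ∀ {p₁ p₂} → p₁ < p₂ → p₂ < n → Admissible a p₁ → Admissible a p₂ → a ‼ p₁ ≢ a ‼ p₂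
    admissible-ordered {p₁} {p₂} p₁<p₂ p₂<n (even⇒≢ , _) (_ , odd⇒≢) a‼p₁≡a‼p₂ with mod2-cases (a ‼ p₁)
    ... | inj₁ even = even⇒≢ even (ℕₚ.≤-<-trans p₁<p₂ p₂<n)
      (ℕₚ.≤-antisym (Decreasing-antitone {a = a} dec (ℕₚ.n≤1+n p₁))
                    (subst (_≤ a ‼ suc p₁) (sym a‼p₁≡a‼p₂) (Decreasing-antitone {a = a} dec p₁<p₂)))
    ... | inj₂ odd = odd⇒≢ (subst (λ y → mod2 y ≡ 1) a‼p₁≡a‼p₂ odd) 0<p₂
      (ℕₚ.≤-antisym (subst (a ‼ ℕ.pred p₂ ≤_) a‼p₁≡a‼p₂ (Decreasing-antitone {a = a} dec (ℕₚ.<⇒≤pred p₁<p₂)))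
                    (Decreasing-antitone {a = a} dec ℕₚ.pred[n]≤n))
      where 0<p₂ = ℕₚ.≤-<-trans z≤n p₁<p₂

  admissible-unique : ∀ {p₁ p₂} → p₁ < n → p₂ < n → Admissible a p₁ → Admissible a p₂ → a ‼ p₁ ≡ a ‼ p₂ → p₁ ≡ p₂
  admissible-unique {p₁} {p₂} p₁<n p₂<n adm₁ adm₂ eq with ℕₚ.<-cmp p₁ p₂
  ... | tri< p₁<p₂ _ _ = ⊥-elim (admissible-ordered p₁<p₂ p₂<n adm₁ adm₂ eq)
  ... | tri≈ _ p₁≡p₂ _ = p₁≡p₂
  ... | tri> _ _ p₂<p₁ = ⊥-elim (admissible-ordered p₂<p₁ p₁<n adm₂ adm₁ (sym eq))

  -- Each value of a has exactly one admissible position, and it occurs mult times.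
  sum-mult-admissible : sum (map (λ p → mult (a ‼ p) a) (admissiblePositions a)) ≡ n
  sum-mult-admissible = begin
    sum (map (λ p → mult (a ‼ p) a) ps)
      ≡⟨ cong sum (Listₚ.map-cong (λ p → mult≡sum (a ‼ p) a) ps) ⟩
    sum (map (λ p → sum (map (λ q → same q p) (upTo n))) ps)
      ≡⟨ sum-map-swap (λ p q → same q p) ps (upTo n) ⟩
    sum (map (λ q → sum (map (λ p → same q p) ps)) (upTo n))
      ≡⟨ cong sum (Listₚ.map-cong-local (All.tabulate one-admissible)) ⟩
    sum (map (λ _ → 1) (upTo n))
      ≡⟨ trans (sum-map-1 (upTo n)) (Listₚ.length-upTo n) ⟩
    n ∎
    where
    open ≡-Reasoning
    ps : List ℕ
    ps = admissiblePositions a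
    same : ℕ → ℕ → ℕ
    same q p = indicator (does (a ‼ q ℕ.≟ a ‼ p))
    one-admissible : ∀ {q} → q ∈ upTo n → sum (map (λ p → same q p) ps) ≡ 1
    one-admissible {q} q∈ with ∈ₚ.∈-applyUpTo⁻ (λ k → k) q∈
    ... | _ , q<n , refl with admissible-exists q<n
    ... | p , p<n , adm , a‼p≡a‼q = trans (sym (length-filter≡sum (λ p → a ‼ q ℕ.≟ a ‼ p) ps))
      (length-filter≡1 (λ p → a ‼ q ℕ.≟ a ‼ p) p (Uniqueₚ.filter⁺ (admissible? a) (Uniqueₚ.upTo⁺ n))
        (∈ₚ.∈-filter⁺ (admissible? a) (∈ₚ.∈-applyUpTo⁺ (λ k → k) p<n) adm) (sym a‼p≡a‼q)
        λ p′∈ a‼q≡a‼p′ → let p′<n , adm′ = ∈-admissiblePositions⁻ a p′∈ in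
          admissible-unique p′<n p<n adm′ adm (trans (sym a‼q≡a‼p′) (sym a‼p≡a‼q)))

multProd : Exp n → ℕ
multProd a = factProd (map (λ j → mult j a) (upTo (suc (maxℕ a))))

∈⇒≤maxℕ : ∀ (v : Exp n) {x} → x ∈ toList v → x ≤ maxℕ v
∈⇒≤maxℕ (y ∷ v) (here refl) = ℕₚ.m≤m⊔n y _
∈⇒≤maxℕ (y ∷ v) (there x∈) = ℕₚ.≤-trans (∈⇒≤maxℕ v x∈) (ℕₚ.m≤n⊔m y _)

maxℕ-lub : ∀ (v : Exp n) {k} → (∀ {x} → x ∈ toList v → x ≤ k) → maxℕ v ≤ k
maxℕ-lub []      _   = z≤n
maxℕ-lub (y ∷ v) ≤k = ℕₚ.⊔-lub (≤k (here refl)) (maxℕ-lub v (≤k ∘ there))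

factProd-++ : ∀ xs ys → factProd (xs ++ ys) ≡ factProd xs * factProd ys
factProd-++ []       ys = sym (ℕₚ.+-identityʳ (factProd ys))
factProd-++ (x ∷ xs) ys = trans (cong (_*_ (x !)) (factProd-++ xs ys)) (sym (ℕₚ.*-assoc (x !) _ _))

factProd-upTo-+ : ∀ (f : ℕ → ℕ) k d → (∀ {j} → k ≤ j → f j ≡ 0) → factProd (map f (upTo (k + d))) ≡ factProd (map f (upTo k))
factProd-upTo-+ f k zero    f≡0 = cong (factProd ∘ map f ∘ upTo) (ℕₚ.+-identityʳ k)
factProd-upTo-+ f k (suc d) f≡0 = begin
  factProd (map f (upTo (k + suc d)))                 ≡⟨ cong (factProd ∘ map f ∘ upTo) (ℕₚ.+-suc k d) ⟩
  factProd (map f (upTo (suc (k + d))))               ≡⟨ cong (factProd ∘ map f) (Listₚ.upTo-∷ʳ (k + d)) ⟨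
  factProd (map f (upTo (k + d) ++ List.[ k + d ]))   ≡⟨ cong factProd (Listₚ.map-++ f (upTo (k + d)) _) ⟩
  factProd (map f (upTo (k + d)) ++ List.[ f (k + d) ]) ≡⟨ factProd-++ (map f (upTo (k + d))) _ ⟩
  factProd (map f (upTo (k + d))) * (f (k + d) ! * 1) ≡⟨ cong (λ y → factProd (map f (upTo (k + d))) * (y ! * 1)) (f≡0 (ℕₚ.m≤m+n k d)) ⟩
  factProd (map f (upTo (k + d))) * 1                 ≡⟨ ℕₚ.*-identityʳ _ ⟩
  factProd (map f (upTo (k + d)))                     ≡⟨ factProd-upTo-+ f k d f≡0 ⟩
  factProd (map f (upTo k))                           ∎
  where open ≡-Reasoning

multProd-upTo : ∀ (v : Exp n) {k} → maxℕ v < k → factProd (map (λ j → mult j v) (upTo k)) ≡ multProd v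
multProd-upTo v {k} max<k = trans (cong (λ k → factProd (map (λ j → mult j v) (upTo k))) (sym (ℕₚ.m+[n∸m]≡n max<k)))
  (factProd-upTo-+ (λ j → mult j v) (suc (maxℕ v)) (k ∸ suc (maxℕ v)) λ {j} max<j →
    cong length (Listₚ.filter-none (ℕ._≟ j) {xs = toList v} (All.tabulate λ { x∈ refl → ℕₚ.<⇒≱ max<j (∈⇒≤maxℕ v x∈) })))

mult-ins : ∀ j p x (v : Exp n) → mult j (ins p x v) ≡ mult j (x ∷ v)
mult-ins j p x v = ↭ₚ.↭-length (↭ₚ.filter-↭ (ℕ._≟ j) (toList-ins-↭ p x v))

factProd-bump : ∀ (F G : ℕ → ℕ) x {js} → Unique js → x ∈ js → F x ≡ suc (G x) → (∀ {j} → j ≢ x → F j ≡ G j) →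
                factProd (map F js) ≡ F x * factProd (map G js)
factProd-bump F G x {j ∷ js} (j∉js ∷ _) (here refl) Fx≡ F≡G = begin
  F j ! * factProd (map F js)          ≡⟨ cong₂ (λ y z → y ! * z) Fx≡ (cong factProd (Listₚ.map-cong-local
                                            (All.tabulate λ k∈ → F≡G (All.lookup j∉js k∈ ∘ sym)))) ⟩
  suc (G j) ! * factProd (map G js)   ≡⟨ ℕₚ.*-assoc (suc (G j)) (G j !) _ ⟩
  suc (G j) * (G j ! * factProd (map G js)) ≡⟨ cong (_* (G j ! * factProd (map G js))) Fx≡ ⟨
  F j * (G j ! * factProd (map G js))  ∎
  where open ≡-Reasoning
factProd-bump F G x {j ∷ js} (j∉js ∷ u) (there x∈) Fx≡ F≡G = begin
  F j ! * factProd (map F js)          ≡⟨ cong₂ (λ y z → y ! * z) (F≡G (All.lookup j∉js x∈)) (factProd-bump F G x u x∈ Fx≡ F≡G) ⟩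
  G j ! * (F x * factProd (map G js))  ≡⟨ x∙yz≈y∙xz (G j !) (F x) _ ⟩
  F x * (G j ! * factProd (map G js))  ∎
  where
  open ≡-Reasoning
  open CommSemigroupProperties ℕₚ.*-commutativeSemigroup using (x∙yz≈y∙xz)

multProd-rem : ∀ (a : Exp (suc m)) {p} → p ≤ m → multProd a ≡ mult (a ‼ p) a * multProd (rem p a)
multProd-rem {m} a {p} p≤m = begin
  multProd a                                        ≡⟨ factProd-bump (λ j → mult j a) (λ j → mult j r) x (Uniqueₚ.upTo⁺ _)
                                                         x∈ mult-x mult-j ⟩
  mult x a * factProd (map (λ j → mult j r) (upTo (suc (maxℕ a))))
                                                    ≡⟨ cong (_*_ (mult x a)) (multProd-upTo r (s≤s (maxℕ-lub r r⊆a))) ⟩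
  mult x a * multProd r                             ∎
  where
  open ≡-Reasoning
  x : ℕ
  x = a ‼ p
  r : Exp m
  r = rem p a
  a≡ : ins p x r ≡ a
  a≡ = ins-rem 0 a p≤m
  x∈ : x ∈ upTo (suc (maxℕ a))
  x∈ = ∈ₚ.∈-applyUpTo⁺ (λ k → k) (s≤s (∈⇒≤maxℕ a (nth-∈ 0 a (s≤s p≤m))))
  r⊆a : ∀ {y} → y ∈ toList r → y ≤ maxℕ a
  r⊆a y∈ = ∈⇒≤maxℕ a (subst (λ v → _ ∈ toList v) a≡ (↭ₚ.∈-resp-↭ (↭-sym (toList-ins-↭ p x r)) (there y∈)))
  mult-x : mult x a ≡ suc (mult x r)
  mult-x = trans (cong (mult x) (sym a≡)) (trans (mult-ins x p x r) (cong length (Listₚ.filter-accept (ℕ._≟ x) refl)))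
  mult-j : ∀ {j} → j ≢ x → mult j a ≡ mult j r
  mult-j j≢x = trans (cong (mult _) (sym a≡)) (trans (mult-ins _ p x r) (cong length (Listₚ.filter-reject (ℕ._≟ _) (j≢x ∘ sym))))

#compatible*multProd : ∀ n (a : Exp n) → Decreasing a → #compatible a * multProd a ≡ n !
#compatible*multProd zero    []  _   = refl
#compatible*multProd (suc m) a   dec = begin
  #compatible a * multProd a
    ≡⟨ cong (_* multProd a) (#compatible-step a dec) ⟩
  sum (map (λ p → #compatible (rem p a)) ps) * multProd a
    ≡⟨ sum-map-*ʳ _ (multProd a) ps ⟩
  sum (map (λ p → #compatible (rem p a) * multProd a) ps)
    ≡⟨ cong sum (Listₚ.map-cong-local (All.tabulate removal)) ⟩
  sum (map (λ p → mult (a ‼ p) a * m !) ps)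
    ≡⟨ sum-map-*ʳ _ (m !) ps ⟨
  sum (map (λ p → mult (a ‼ p) a) ps) * m !
    ≡⟨ cong (_* m !) (sum-mult-admissible a dec) ⟩
  suc m ! ∎
  where
  open ≡-Reasoning
  open CommSemigroupProperties ℕₚ.*-commutativeSemigroup using (x∙yz≈y∙xz)
  ps : List ℕ
  ps = admissiblePositions a
  removal : ∀ {p} → p ∈ ps → #compatible (rem p a) * multProd a ≡ mult (a ‼ p) a * m !
  removal {p} p∈ = let p≤m = ℕₚ.≤-pred (proj₁ (∈-admissiblePositions⁻ a p∈)) in begin
    #compatible (rem p a) * multProd a                               ≡⟨ cong (_*_ (#compatible (rem p a))) (multProd-rem a p≤m) ⟩
    #compatible (rem p a) * (mult (a ‼ p) a * multProd (rem p a))    ≡⟨ x∙yz≈y∙xz (#compatible (rem p a)) (mult (a ‼ p) a) (multProd (rem p a)) ⟩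
    mult (a ‼ p) a * (#compatible (rem p a) * multProd (rem p a))    ≡⟨ cong (_*_ (mult (a ‼ p) a)) (#compatible*multProd m (rem p a) (Decreasing-rem p a dec)) ⟩
    mult (a ‼ p) a * m !                                              ∎

weaklyDecreasing⇒Decreasing : ∀ (a : Exp n) → weaklyDecreasing (toList a) ≡ true → Decreasing a
weaklyDecreasing⇒Decreasing []          _  ()
weaklyDecreasing⇒Decreasing (x ∷ [])    _  (s≤s ())
weaklyDecreasing⇒Decreasing (x ∷ y ∷ a) wd {c} 1+c<n with y ℕ.≤? x | c | 1+c<n
... | yes y≤x | zero  | _            = y≤x
... | yes _   | suc c | s≤s 1+c<2+n = weaklyDecreasing⇒Decreasing (y ∷ a) wd 1+c<2+n
... | no _    | _     | _            = case wd of λ ()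

Decreasing⇒weaklyDecreasing : ∀ (a : Exp n) → Decreasing a → weaklyDecreasing (toList a) ≡ true
Decreasing⇒weaklyDecreasing []          _   = refl
Decreasing⇒weaklyDecreasing (x ∷ [])    _   = refl
Decreasing⇒weaklyDecreasing (x ∷ y ∷ a) dec =
  trans (cong (if_then weaklyDecreasing (y ∷ toList a) else false) (⌊⌋-true (y ℕ.≤? x) (dec (s≤s (s≤s z≤n)))))
        (Decreasing⇒weaklyDecreasing (y ∷ a) (dec ∘ s≤s))

lhs≡#compatible : ∀ n (a : Exp n) → lhs n a ≡ + #compatible a
lhs≡#compatible n a with weaklyDecreasing (toList a) in wd
... | true  = cong +_ (begin
  (n ! / multProd a) {{nz}}                           ≡⟨ cong (λ k → (k / multProd a) {{nz}}) (#compatible*multProd n a (weaklyDecreasing⇒Decreasing a wd)) ⟨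
  (#compatible a * multProd a / multProd a) {{nz}}    ≡⟨ m*n/n≡m (#compatible a) (multProd a) {{nz}} ⟩
  #compatible a                                       ∎)
  where
  open ≡-Reasoning
  nz : ℕ.NonZero (multProd a)
  nz = factProd≢0 (map (λ j → mult j a) (upTo (suc (maxℕ a))))
... | false = cong +_ (sym (cong length (Listₚ.filter-none (compatible? a) {xs = Bn n} (All.tabulate λ {σ} _ compat →
  case trans (sym wd) (Decreasing⇒weaklyDecreasing a (Compatible⇒Decreasing {a = a} {σ} compat)) of λ ()))))

-- The identity also holds for n = 0.
theorem6p5 : (n : ℕ) → 1 ≤ n → (a : Exp n) → lhs n a ≡ rhs n a
theorem6p5 n _ a = trans (lhs≡#compatible n a) (sym (rhs≡#compatible n a))
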